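{- Let $F$ be an $r$-regular finite simple bipartite graph on $n_F$ vertices, where $r\ge 1$, and let $G$ be a finite simple bipartite graph containing no cycle of length $4$. Then \[ \hom(F,G)\le\Biggl(2\sum_{w\in V(G)}d_G(w)^{r}-2|E(G)|\Biggr)^{\frac{n_F}{2r}}. \] In particular, if $T$ is a tree on $n_T$ vertices, then \[ \hom(F,T)\le\Biggl(2\sum_{w\in V(T)}d_T(w)^{r}-2(n_T-1)\Biggr)^{\frac{n_F}{2r}}. \]
   Context: $\hom(F,G)$ is the number of maps $\phi:V(F)\to V(G)$ sending every edge of $F$ to an edge of $G$; $d_H(w)$ denotes the degree of $w$ in $H$. -}

module Defs where

open import Data.Nat using (ℕ; zero; suc; _+_; _*_; _∸_; _^_; _≤_; _<ᵇ_)
open import Data.Bool using (Bool; true; false; if_then_else_; not; _∨_)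
open import Data.Fin using (Fin; zero; suc; toℕ; inject₁; fromℕ)
open import Data.List using (List; []; _∷_; map; allFin; concatMap)
open import Data.Nat.ListAction using (sum)
open import Data.Product using (Σ; _×_; ∃)
open import Function.Definitions using (Injective)
open import Relation.Binary.PropositionalEquality using (_≡_; _≢_)
open import Relation.Nullary using (¬_)

record Graph (n : ℕ) : Set where
  field
    adj   : Fin n → Fin n → Bool
    sym   : ∀ u v → adj u v ≡ adj v u
    irrefl : ∀ u → adj u u ≡ false
open Graph public

Adj : ∀ {n} → Graph n → Fin n → Fin n → Set
Adj G u v = adj G u v ≡ true

⌊_⌋ : Bool → ℕ
⌊ b ⌋ = if b then 1 else 0

ΣV : (n : ℕ) → (Fin n → ℕ) → ℕ
ΣV n f = sum (map f (allFin n))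

deg : ∀ {n} → Graph n → Fin n → ℕ
deg {n} G v = ΣV n (λ u → ⌊ adj G v u ⌋)

edges : ∀ {n} → Graph n → ℕ
edges {n} G = ΣV n (λ u → ΣV n (λ v → ⌊ adj G u v ⌋ * ⌊ toℕ u <ᵇ toℕ v ⌋))

Regular : ∀ {n} → Graph n → ℕ → Set
Regular G r = ∀ v → deg G v ≡ r

Bipartite : ∀ {n} → Graph n → Set
Bipartite {n} G = Σ (Fin n → Bool) λ c → ∀ u v → Adj G u v → c u ≢ c v

-- a cycle of length k+3: injective cyclic sequence of vertices,
-- consecutive ones adjacent, last adjacent to first
CycleOfLength : ∀ {n} → Graph n → ℕ → Set
CycleOfLength {n} G k =
  Σ (Fin (suc (suc (suc k))) → Fin n) λ c →
    Injective _≡_ _≡_ c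
    × (∀ (i : Fin (suc (suc k))) → Adj G (c (inject₁ i)) (c (suc i)))
    × Adj G (c (fromℕ (suc (suc k)))) (c zero)

C4Free : ∀ {n} → Graph n → Set
C4Free G = ¬ CycleOfLength G 1

data Walk {n} (G : Graph n) : Fin n → Fin n → Set where
  [] : ∀ {u} → Walk G u u
  _∷_ : ∀ {u v w} → Adj G u v → Walk G v w → Walk G u w

Connected : ∀ {n} → Graph n → Set
Connected {n} G = 1 ≤ n × (∀ u v → Walk G u v)

Acyclic : ∀ {n} → Graph n → Set
Acyclic G = ∀ k → ¬ CycleOfLength G k

IsTree : ∀ {n} → Graph n → Set
IsTree G = Connected G × Acyclic G

consF : ∀ {n m} → Fin m → (Fin n → Fin m) → Fin (suc n) → Fin m
consF j f zero = j
consF j f (suc i) = f i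

allFuns : (n m : ℕ) → List (Fin n → Fin m)
allFuns zero m = (λ ()) ∷ []
allFuns (suc n) m = concatMap (λ f → map (λ j → consF j f) (allFin m)) (allFuns n m)

allᵇ : ∀ {A : Set} → (A → Bool) → List A → Bool
allᵇ p [] = true
allᵇ p (x ∷ xs) = if p x then allᵇ p xs else false

isHom : ∀ {n m} → Graph n → Graph m → (Fin n → Fin m) → Bool
isHom {n} F G φ = allᵇ (λ u → allᵇ (λ v → not (adj F u v) ∨ adj G (φ u) (φ v)) (allFin n)) (allFin n)

hom : ∀ {n m} → Graph n → Graph m → ℕ
hom {n} {m} F G = sum (map (λ φ → ⌊ isHom F G φ ⌋) (allFuns n m))

-- Colour V(F) with classes A and B. Summing first over the images of B gives
-- hom(F,G) = Σ_{x : A → V(G)} Π_{b ∈ B} c(x|N(b)), where c counts common neighbours.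
-- Every a ∈ A lies in exactly r of the sets N(b), so Finner's generalised Hölder
-- inequality (derived from AM–GM by induction on the coordinates) gives
-- hom(F,G)^r ≤ Π_{b ∈ B} Σ_{y : N(b) → V(G)} c(y)^r = hom(K_{r,r},G)^|B|, and the same
-- with the roles of A and B exchanged; the product of the two bounds has exponent n_F.
-- In a C4-free graph distinct vertices have at most one common neighbour, so c(y)^r = c(y)
-- unless y is constant, where c(w,…,w) = d(w). Since Σ_y c(y) = Σ_w d(w)^r and
-- Σ_w d(w) = 2|E|, this gives hom(K_{r,r},G) = 2 Σ_w d(w)^r − 2|E(G)|.
-- A tree is C4-free and, being connected, has at least n_T − 1 edges.

module Submission where

open import Defs renaming (sym to adj-sym)
open import Data.Nat using (ℕ; zero; suc; _+_; _*_; _∸_; _^_; _≤_; _<_; z≤n; s≤s; s≤s⁻¹; NonZero; _<ᵇ_)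
open import Data.Nat.Properties
open import Data.Nat.Tactic.RingSolver using (solve-∀)
open import Data.Bool using (Bool; true; false; if_then_else_; not; _∧_; _∨_)
open import Data.Bool.Properties using (¬-not; ∧-zeroʳ; ∧-identityʳ; not-injective) renaming (_≟_ to _≟ᵇ_)
open import Data.Fin using (Fin; zero; suc; toℕ; inject₁)
import Data.Fin.Properties as Fin
open import Data.Vec using (Vec; []; _∷_; _∷ʳ_; head; lookup; tabulate; replicate)
open import Data.Vec.Properties using (lookup∘tabulate)
open import Data.Product using (_×_; ∃; ∃-syntax; _,_; proj₁; proj₂)
import Data.List as List using (List; []; _∷_; _++_; map; concatMap; tabulate; allFin)
import Data.List.Properties as List using (map-tabulate; map-++; map-cong; map-∘)
import Data.Nat.ListAction as List using (sum)
import Data.Nat.ListAction.Properties as List using (sum-++)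
open import Data.Sum using (_⊎_; inj₁; inj₂)
open import Data.Empty using (⊥)
open import Relation.Nullary using (¬_; Dec; yes; no; does; contradiction; _×-dec_; _⊎-dec_)
open import Function using (_∘_)
open import Relation.Binary.PropositionalEquality
open import Algebra.Properties.CommutativeMonoid.Sum +-0-commutativeMonoid
  using (sum-syntax; sum-cong-≗; ∑-comm; ∑-distrib-+; sum-replicate-zero)
open import Algebra.Properties.Semiring.Sum +-*-semiring using (*-distribˡ-sum; *-distribʳ-sum)
import Algebra.Properties.CommutativeMonoid.Sum *-1-commutativeMonoid as Product
open import Algebra.Properties.CommutativeSemigroup *-commutativeSemigroup
  using (x∙yz≈y∙xz; xy∙z≈xz∙y) renaming (interchange to *-interchange)

-- Finite sums and products

product : ∀ {n} → (Fin n → ℕ) → ℕ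
product = Product.sum

infixl 10 product-syntax

product-syntax : ∀ n → (Fin n → ℕ) → ℕ
product-syntax _ = product

syntax product-syntax n (λ i → x) = ∏[ i < n ] x

∏-cong : ∀ {n} {f g : Fin n → ℕ} → (∀ i → f i ≡ g i) → ∏[ i < n ] f i ≡ ∏[ i < n ] g i
∏-cong = Product.sum-cong-≗

∏-comm : ∀ {m n} (f : Fin m → Fin n → ℕ) → ∏[ i < m ] ∏[ j < n ] f i j ≡ ∏[ j < n ] ∏[ i < m ] f i j
∏-comm = Product.∑-comm

∏-distrib-* : ∀ {n} (f g : Fin n → ℕ) → ∏[ i < n ] (f i * g i) ≡ ∏[ i < n ] f i * ∏[ i < n ] g i
∏-distrib-* = Product.∑-distrib-+

∑-mono-≤ : ∀ {n} {f g : Fin n → ℕ} → (∀ i → f i ≤ g i) → ∑[ i < n ] f i ≤ ∑[ i < n ] g i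
∑-mono-≤ {zero} _ = z≤n
∑-mono-≤ {suc n} f≤g = +-mono-≤ (f≤g zero) (∑-mono-≤ (f≤g ∘ suc))

∏-mono-≤ : ∀ {n} {f g : Fin n → ℕ} → (∀ i → f i ≤ g i) → ∏[ i < n ] f i ≤ ∏[ i < n ] g i
∏-mono-≤ {zero} _ = ≤-refl
∏-mono-≤ {suc n} f≤g = *-mono-≤ (f≤g zero) (∏-mono-≤ (f≤g ∘ suc))

∑-const : ∀ n c → ∑[ i < n ] c ≡ n * c
∑-const zero c = refl
∑-const (suc n) c = cong (c +_) (∑-const n c)

∏-const : ∀ n c → ∏[ i < n ] c ≡ c ^ n
∏-const zero c = refl
∏-const (suc n) c = cong (c *_) (∏-const n c)

∏-^ : ∀ {n} k (f : Fin n → ℕ) → ∏[ i < n ] (f i ^ k) ≡ (∏[ i < n ] f i) ^ k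
∏-^ {n} zero f = Product.sum-replicate-zero n
∏-^ (suc k) f = trans (∏-distrib-* f (λ i → f i ^ k)) (cong (product f *_) (∏-^ k f))

term≤∑ : ∀ {n} (f : Fin n → ℕ) i → f i ≤ ∑[ j < n ] f j
term≤∑ f zero = m≤m+n _ _
term≤∑ f (suc i) = ≤-trans (term≤∑ (f ∘ suc) i) (m≤n+m _ _)

positive-term : ∀ {n} (f : Fin n → ℕ) → 1 ≤ ∑[ j < n ] f j → ∃[ j ] 1 ≤ f j
positive-term {suc n} f 1≤∑ with f zero in f₀
... | suc _ = zero , subst (1 ≤_) (sym f₀) (s≤s z≤n)
... | zero = let (j , 1≤fj) = positive-term (f ∘ suc) 1≤∑ in suc j , 1≤fj

two-positive-terms : ∀ {n} (f : Fin n → ℕ) → (∀ j → f j ≤ 1) → 2 ≤ ∑[ j < n ] f j →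
  ∃[ j₁ ] ∃[ j₂ ] j₁ ≢ j₂ × 1 ≤ f j₁ × 1 ≤ f j₂
two-positive-terms {suc n} f f≤1 2≤∑ with f zero in f₀
... | zero = let (j₁ , j₂ , j₁≢j₂ , p₁ , p₂) = two-positive-terms (f ∘ suc) (f≤1 ∘ suc) 2≤∑
             in suc j₁ , suc j₂ , (λ e → j₁≢j₂ (Fin.suc-injective e)) , p₁ , p₂
... | suc zero = let (j , p) = positive-term (f ∘ suc) (s≤s⁻¹ 2≤∑)
                 in zero , suc j , (λ ()) , subst (1 ≤_) (sym f₀) (s≤s z≤n) , p
... | suc (suc _) = contradiction (subst (_≤ 1) f₀ (f≤1 zero)) λ { (s≤s ()) }

⌊⌋≤1 : ∀ b → ⌊ b ⌋ ≤ 1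
⌊⌋≤1 true = ≤-refl
⌊⌋≤1 false = z≤n

⌊⌋-^ : ∀ b k → ⌊ b ⌋ ^ suc k ≡ ⌊ b ⌋
⌊⌋-^ true k = trans (*-identityˡ _) (^-zeroˡ k)
⌊⌋-^ false k = refl

⌊⌋-pos : ∀ {b} → 1 ≤ ⌊ b ⌋ → b ≡ true
⌊⌋-pos {true} _ = refl

δ : ∀ {M} → Fin M → Fin M → ℕ
δ u w = ⌊ does (u Fin.≟ w) ⌋

δ≤1 : ∀ {M} (u w : Fin M) → δ u w ≤ 1
δ≤1 u w = ⌊⌋≤1 (does (u Fin.≟ w))

δ-refl : ∀ {M} (a : Fin M) → δ a a ≡ 1
δ-refl zero = refl
δ-refl (suc a) = δ-refl a

∑-δ : ∀ {M} (f : Fin M → ℕ) w → ∑[ j < M ] (δ j w * f j) ≡ f w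
∑-δ {suc M} f zero = trans (cong₂ _+_ (+-identityʳ (f zero)) (sum-replicate-zero M)) (+-identityʳ _)
∑-δ {suc M} f (suc w) = ∑-δ (f ∘ suc) w

∑-δʳ : ∀ {M} (a : Fin M) → ∑[ w < M ] δ a w ≡ 1
∑-δʳ {suc M} zero = cong suc (sum-replicate-zero M)
∑-δʳ {suc M} (suc a) = ∑-δʳ a

δ+δ≤1 : ∀ {M} (a b e f : Fin M) → ¬ (a ≡ b × e ≡ f) → δ a b + δ e f ≤ 1
δ+δ≤1 a b e f not-both with a Fin.≟ b | e Fin.≟ f
... | yes a≡b | yes e≡f = contradiction (a≡b , e≡f) not-both
... | yes _ | no _ = ≤-refl
... | no _ | yes _ = ≤-refl
... | no _ | no _ = z≤n

∣_∣ : ∀ {n} → (Fin n → Bool) → ℕ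
∣_∣ {n} S = ∑[ i < n ] ⌊ S i ⌋

∣c∣+∣not∘c∣ : ∀ {n} (c : Fin n → Bool) → ∣ c ∣ + ∣ not ∘ c ∣ ≡ n
∣c∣+∣not∘c∣ {n} c = trans (sym (∑-distrib-+ (λ i → ⌊ c i ⌋) (λ i → ⌊ not (c i) ⌋)))
  (trans (sum-cong-≗ (λ i → one-side (c i))) (trans (∑-const n 1) (*-identityʳ n)))
  where
    one-side : ∀ b → ⌊ b ⌋ + ⌊ not b ⌋ ≡ 1
    one-side true = refl
    one-side false = refl

member-of-nonempty : ∀ {n} (S : Fin n → Bool) → 1 ≤ ∣ S ∣ → ∃[ i ] S i ≡ true
member-of-nonempty S 1≤∣S∣ = let (i , 1≤Si) = positive-term (λ i → ⌊ S i ⌋) 1≤∣S∣ in i , ⌊⌋-pos 1≤Si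

∏On : ∀ {n} → (Fin n → Bool) → (Fin n → ℕ) → ℕ
∏On {n} S f = ∏[ i < n ] (if S i then f i else 1)

∏On-const : ∀ {n} (S : Fin n → Bool) c → ∏On S (λ _ → c) ≡ c ^ ∣ S ∣
∏On-const {zero} S c = refl
∏On-const {suc n} S c with S zero
... | true = cong (c *_) (∏On-const (S ∘ suc) c)
... | false = trans (+-identityʳ _) (∏On-const (S ∘ suc) c)

∏On-^ : ∀ {n} k (S : Fin n → Bool) (f : Fin n → ℕ) → ∏On S f ^ k ≡ ∏On S (λ i → f i ^ k)
∏On-^ k S f = trans (sym (∏-^ k (λ i → if S i then f i else 1))) (∏-cong (λ i → if-^ (S i) (f i)))
  where
    if-^ : ∀ b x → (if b then x else 1) ^ k ≡ (if b then x ^ k else 1)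
    if-^ true x = refl
    if-^ false x = ^-zeroˡ k

∏-if : ∀ {n} (S : Fin n → Bool) (f g : Fin n → ℕ) →
  ∏[ i < n ] (if S i then f i else g i) ≡ ∏On S f * ∏On (not ∘ S) g
∏-if S f g = trans (∏-cong (λ i → split (S i))) (∏-distrib-* (λ i → if S i then f i else 1) _)
  where
    split : ∀ b {x y} → (if b then x else y) ≡ (if b then x else 1) * (if not b then y else 1)
    split true = sym (*-identityʳ _)
    split false = sym (+-identityʳ _)

∏On-cong : ∀ {n} (S : Fin n → Bool) {f g : Fin n → ℕ} → (∀ i → S i ≡ true → f i ≡ g i) → ∏On S f ≡ ∏On S g
∏On-cong S f≡g = ∏-cong (λ i → on-support (S i) refl)
  where
    on-support : ∀ {i} s → S i ≡ s → (if s then _ else 1) ≡ (if s then _ else 1)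
    on-support true Si = f≡g _ Si
    on-support false _ = refl

∏On-ones : ∀ {n} (S : Fin n → Bool) {f : Fin n → ℕ} → (∀ i → S i ≡ true → f i ≡ 1) → ∏On S f ≡ 1
∏On-ones S f≡1 = trans (∏On-cong S f≡1) (trans (∏On-const S 1) (^-zeroˡ ∣ S ∣))

if-≤1 : ∀ s {x} → x ≤ 1 → (if s then x else 1) ≤ 1
if-≤1 true x≤1 = x≤1
if-≤1 false _ = ≤-refl

∏On≤1 : ∀ {n} (S : Fin n → Bool) {f : Fin n → ℕ} → (∀ i → f i ≤ 1) → ∏On S f ≤ 1
∏On≤1 {n} S f≤1 = ≤-trans (∏-mono-≤ (λ i → if-≤1 (S i) (f≤1 i))) (≤-reflexive (Product.sum-replicate-zero n))

∏On≤factor : ∀ {n} (S : Fin n → Bool) {f : Fin n → ℕ} {i} → (∀ i → f i ≤ 1) → S i ≡ true → ∏On S f ≤ f i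
∏On≤factor S {f} {zero} f≤1 S₀ rewrite S₀ =
  ≤-trans (*-monoʳ-≤ (f zero) (∏On≤1 (S ∘ suc) (f≤1 ∘ suc))) (≤-reflexive (*-identityʳ (f zero)))
∏On≤factor S {f} {suc i} f≤1 Si =
  ≤-trans (*-monoˡ-≤ _ (if-≤1 (S zero) (f≤1 zero)))
          (≤-trans (≤-reflexive (+-identityʳ _)) (∏On≤factor (S ∘ suc) (f≤1 ∘ suc) Si))

*-idem-≤1 : ∀ {x} → x ≤ 1 → x * x ≡ x
*-idem-≤1 z≤n = refl
*-idem-≤1 (s≤s z≤n) = refl

ΣV≡∑ : ∀ n (f : Fin n → ℕ) → ΣV n f ≡ ∑[ i < n ] f i
ΣV≡∑ n f = trans (cong List.sum (List.map-tabulate (λ i → i) f)) (sum-tabulate f)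
  where
    sum-tabulate : ∀ {n} (f : Fin n → ℕ) → List.sum (List.tabulate f) ≡ ∑[ i < n ] f i
    sum-tabulate {zero} f = refl
    sum-tabulate {suc n} f = cong (f zero +_) (sum-tabulate (f ∘ suc))

<ᵇ-trichotomy : ∀ a b → a ≢ b → ⌊ a <ᵇ b ⌋ + ⌊ b <ᵇ a ⌋ ≡ 1
<ᵇ-trichotomy zero zero a≢b = contradiction refl a≢b
<ᵇ-trichotomy zero (suc b) _ = refl
<ᵇ-trichotomy (suc a) zero _ = refl
<ᵇ-trichotomy (suc a) (suc b) a≢b = <ᵇ-trichotomy a b (a≢b ∘ cong suc)

∑∑-upper-triangle : ∀ {n} (g : Fin n → Fin n → ℕ) → (∀ u → g u u ≡ 0) →
  ∑[ u < n ] ∑[ v < n ] g u v ≡ ∑[ u < n ] ∑[ v < n ] ((g u v + g v u) * ⌊ toℕ u <ᵇ toℕ v ⌋)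
∑∑-upper-triangle {n} g diagonal = begin
  ∑[ u < n ] ∑[ v < n ] g u v
    ≡⟨ sum-cong-≗ (λ u → sum-cong-≗ (λ v → by-order u v)) ⟩
  ∑[ u < n ] ∑[ v < n ] (g u v * lt u v + g u v * lt v u)
    ≡⟨ ∑∑-distrib-+ (λ u v → g u v * lt u v) (λ u v → g u v * lt v u) ⟩
  ∑[ u < n ] ∑[ v < n ] (g u v * lt u v) + ∑[ u < n ] ∑[ v < n ] (g u v * lt v u)
    ≡⟨ cong (∑[ u < n ] ∑[ v < n ] (g u v * lt u v) +_) (∑-comm (λ u v → g u v * lt v u)) ⟩
  ∑[ u < n ] ∑[ v < n ] (g u v * lt u v) + ∑[ u < n ] ∑[ v < n ] (g v u * lt u v)
    ≡⟨ sym (∑∑-distrib-+ (λ u v → g u v * lt u v) (λ u v → g v u * lt u v)) ⟩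
  ∑[ u < n ] ∑[ v < n ] (g u v * lt u v + g v u * lt u v)
    ≡⟨ sum-cong-≗ (λ u → sum-cong-≗ (λ v → sym (*-distribʳ-+ (lt u v) (g u v) (g v u)))) ⟩
  ∑[ u < n ] ∑[ v < n ] ((g u v + g v u) * lt u v)
    ∎
  where
    open ≡-Reasoning
    lt : Fin n → Fin n → ℕ
    lt u v = ⌊ toℕ u <ᵇ toℕ v ⌋

    ∑∑-distrib-+ : (f h : Fin n → Fin n → ℕ) →
      ∑[ u < n ] ∑[ v < n ] (f u v + h u v) ≡ ∑[ u < n ] ∑[ v < n ] f u v + ∑[ u < n ] ∑[ v < n ] h u v
    ∑∑-distrib-+ f h = trans (sum-cong-≗ (λ u → ∑-distrib-+ (f u) (h u))) (∑-distrib-+ {n} _ _)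

    by-order : ∀ u v → g u v ≡ g u v * lt u v + g u v * lt v u
    by-order u v with u Fin.≟ v
    ... | yes refl = trans (diagonal u) (sym (cong (λ x → x * lt u u + x * lt u u) (diagonal u)))
    ... | no u≢v = trans (sym (*-identityʳ (g u v)))
      (trans (cong (g u v *_) (sym (<ᵇ-trichotomy (toℕ u) (toℕ v) (u≢v ∘ Fin.toℕ-injective))))
             (*-distribˡ-+ (g u v) (lt u v) (lt v u)))

-- AM–GM

^-distribʳ-* : ∀ a b n → (a * b) ^ n ≡ a ^ n * b ^ n
^-distribʳ-* a b zero = refl
^-distribʳ-* a b (suc n) = trans (cong (a * b *_) (^-distribʳ-* a b n)) (*-interchange a b (a ^ n) (b ^ n))

^-cancelʳ-≤ : ∀ r .{{_ : NonZero r}} {a b} → a ^ r ≤ b ^ r → a ≤ b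
^-cancelʳ-≤ r aʳ≤bʳ = ≮⇒≥ (λ b<a → <⇒≱ (^-monoˡ-< r b<a) aʳ≤bʳ)

bernoulli : ∀ n p q → p ^ n * (p + suc n * q) ≤ (p + q) ^ suc n
bernoulli zero p q = ≤-reflexive (base p q)
  where
    base : ∀ p q → 1 * (p + 1 * q) ≡ (p + q) * 1
    base = solve-∀
bernoulli (suc n) p q = begin
  p ^ suc n * (p + suc (suc n) * q)                                ≤⟨ m≤m+n _ _ ⟩
  p ^ suc n * (p + suc (suc n) * q) + p ^ n * suc n * q * q        ≡⟨ expand p q (p ^ n) n ⟩
  (p + q) * (p ^ n * (p + suc n * q))                              ≤⟨ *-monoʳ-≤ (p + q) (bernoulli n p q) ⟩
  (p + q) * (p + q) ^ suc n                                        ∎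
  where
    open ≤-Reasoning
    expand : ∀ p q P n → p * P * (p + suc (suc n) * q) + P * suc n * q * q ≡ (p + q) * (P * (p + suc n * q))
    expand = solve-∀

bernoulli-upper : ∀ n a q → (a + q) ^ suc n ≤ a ^ suc n + suc n * q * (a + q) ^ n
bernoulli-upper zero a q = ≤-reflexive (base a q)
  where
    base : ∀ a q → (a + q) * 1 ≡ a * 1 + 1 * q * 1
    base = solve-∀
bernoulli-upper (suc n) a q = begin
  (a + q) * (a + q) ^ suc n
    ≤⟨ *-monoʳ-≤ (a + q) (bernoulli-upper n a q) ⟩
  (a + q) * (a ^ suc n + suc n * q * (a + q) ^ n)
    ≡⟨ expand a q (a ^ suc n) ((a + q) ^ n) n ⟩
  a * a ^ suc n + q * a ^ suc n + suc n * q * ((a + q) * (a + q) ^ n)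
    ≤⟨ +-monoˡ-≤ _ (+-monoʳ-≤ (a * a ^ suc n) (*-monoʳ-≤ q (^-monoˡ-≤ (suc n) (m≤m+n a q)))) ⟩
  a * a ^ suc n + q * (a + q) ^ suc n + suc n * q * (a + q) ^ suc n
    ≡⟨ collect (a * a ^ suc n) q ((a + q) ^ suc n) n ⟩
  a * a ^ suc n + suc (suc n) * q * (a + q) ^ suc n
    ∎
  where
    open ≤-Reasoning
    expand : ∀ a q A B n → (a + q) * (A + suc n * q * B) ≡ a * A + q * A + suc n * q * ((a + q) * B)
    expand = solve-∀
    collect : ∀ X q Y n → X + q * Y + suc n * q * Y ≡ X + suc (suc n) * q * Y
    collect = solve-∀

-- With p = (K+1) S this is Bernoulli's inequality p^K (p + (K+1) t) ≤ (p + t)^(K+1)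
-- for the increment t = K y − S, whose sign decides which of the two forms applies.
amgm-step-scaled : ∀ K S y → (suc K * S) ^ K * (suc K * K * y) ≤ (K * (S + y)) ^ suc K
amgm-step-scaled K S y with ≤-total S (K * y)
... | inj₁ S≤Ky = subst₂ _≤_ (cong ((suc K * S) ^ K *_) lhs) (cong (_^ suc K) rhs) (bernoulli K (suc K * S) t)
  where
    t = K * y ∸ S
    S+t : S + t ≡ K * y
    S+t = m+[n∸m]≡n S≤Ky
    lhs : suc K * S + suc K * t ≡ suc K * K * y
    lhs = trans (sym (*-distribˡ-+ (suc K) S t)) (trans (cong (suc K *_) S+t) (sym (*-assoc (suc K) K y)))
    rhs : suc K * S + t ≡ K * (S + y)
    rhs = trans (shift K S t) (trans (cong (K * S +_) S+t) (sym (*-distribˡ-+ K S y)))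
      where
        shift : ∀ K S t → suc K * S + t ≡ K * S + (S + t)
        shift = solve-∀
... | inj₂ Ky≤S = +-cancelʳ-≤ _ _ _ (subst₂ _≤_ total (cong (λ z → a ^ suc K + suc K * t * z ^ K) a+t) upper)
  where
    t = S ∸ K * y
    a = K * (S + y)
    Ky+t : K * y + t ≡ S
    Ky+t = m+[n∸m]≡n Ky≤S
    a+t : a + t ≡ suc K * S
    a+t = trans (cong (_+ t) (*-distribˡ-+ K S y)) (trans (+-assoc (K * S) (K * y) t) (trans (cong (K * S +_) Ky+t) (+-comm (K * S) S)))
    upper : (a + t) ^ suc K ≤ a ^ suc K + suc K * t * (a + t) ^ K
    upper = bernoulli-upper K a t
    total : (a + t) ^ suc K ≡ (suc K * S) ^ K * (suc K * K * y) + suc K * t * (suc K * S) ^ K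
    total = trans (cong (_^ suc K) a+t) (trans (cong (λ z → suc K * z * (suc K * S) ^ K) (sym Ky+t)) (regroup t y K ((suc K * S) ^ K)))
      where
        regroup : ∀ t y K P → suc K * (K * y + t) * P ≡ P * (suc K * K * y) + suc K * t * P
        regroup = solve-∀

amgm-step : ∀ K S y → suc K ^ suc K * S ^ K * y ≤ K ^ K * (S + y) ^ suc K
amgm-step zero S y = subst₂ _≤_ (lhs y) (rhs S y) (m≤n+m y S)
  where
    lhs : ∀ y → y ≡ (1 * 1) * 1 * y
    lhs = solve-∀
    rhs : ∀ S y → S + y ≡ 1 * ((S + y) * 1)
    rhs = solve-∀
amgm-step K@(suc _) S y = *-cancelˡ-≤ K (subst₂ _≤_ lhs rhs (amgm-step-scaled K S y))
  where
    lhs : (suc K * S) ^ K * (suc K * K * y) ≡ K * (suc K ^ suc K * S ^ K * y)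
    lhs = trans (cong (_* (suc K * K * y)) (^-distribʳ-* (suc K) S K)) (regroup (suc K ^ K) (S ^ K) y K)
      where
        regroup : ∀ A B y K → A * B * (suc K * K * y) ≡ K * (suc K * A * B * y)
        regroup = solve-∀
    rhs : (K * (S + y)) ^ suc K ≡ K * (K ^ K * (S + y) ^ suc K)
    rhs = trans (^-distribʳ-* K (S + y) (suc K)) (*-assoc K (K ^ K) _)

amgm : ∀ k (X : Fin k → ℕ) → k ^ k * ∏[ i < k ] X i ≤ (∑[ i < k ] X i) ^ k
amgm zero X = ≤-refl
amgm (suc zero) X = ≤-reflexive (one (X zero))
  where
    one : ∀ x → (1 * 1) * (x * 1) ≡ (x + 0) * 1
    one = solve-∀
amgm (suc K@(suc _)) X = *-cancelˡ-≤ (K ^ K) {{m^n≢0 K K}} (begin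
  K ^ K * (suc K ^ suc K * (x * P))    ≡⟨ regroup (K ^ K) (suc K ^ suc K) x P ⟩
  suc K ^ suc K * x * (K ^ K * P)      ≤⟨ *-monoʳ-≤ (suc K ^ suc K * x) (amgm K (X ∘ suc)) ⟩
  suc K ^ suc K * x * S ^ K            ≡⟨ xy∙z≈xz∙y (suc K ^ suc K) x (S ^ K) ⟩
  suc K ^ suc K * S ^ K * x            ≤⟨ amgm-step K S x ⟩
  K ^ K * (S + x) ^ suc K              ≡⟨ cong (λ z → K ^ K * z ^ suc K) (+-comm S x) ⟩
  K ^ K * (x + S) ^ suc K              ∎)
  where
    open ≤-Reasoning
    x = X zero
    P = ∏[ i < K ] X (suc i)
    S = ∑[ i < K ] X (suc i)
    regroup : ∀ a b c d → a * (b * (c * d)) ≡ b * c * (a * d)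
    regroup = solve-∀

-- Sums over tuples

module _ {M : ℕ} where

  ∑Vec : ∀ n → (Vec (Fin M) n → ℕ) → ℕ
  ∑Vec zero f = f []
  ∑Vec (suc n) f = ∑[ j < M ] ∑Vec n (λ x → f (j ∷ x))

  ∑Vec-cong : ∀ n {f g : Vec (Fin M) n → ℕ} → (∀ x → f x ≡ g x) → ∑Vec n f ≡ ∑Vec n g
  ∑Vec-cong zero f≡g = f≡g []
  ∑Vec-cong (suc n) f≡g = sum-cong-≗ (λ j → ∑Vec-cong n (λ x → f≡g (j ∷ x)))

  ∑Vec-mono-≤ : ∀ n {f g : Vec (Fin M) n → ℕ} → (∀ x → f x ≤ g x) → ∑Vec n f ≤ ∑Vec n g
  ∑Vec-mono-≤ zero f≤g = f≤g []
  ∑Vec-mono-≤ (suc n) f≤g = ∑-mono-≤ (λ j → ∑Vec-mono-≤ n (λ x → f≤g (j ∷ x)))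

  *-distribˡ-∑Vec : ∀ n c (f : Vec (Fin M) n → ℕ) → c * ∑Vec n f ≡ ∑Vec n (λ x → c * f x)
  *-distribˡ-∑Vec zero c f = refl
  *-distribˡ-∑Vec (suc n) c f =
    trans (*-distribˡ-sum c (λ j → ∑Vec n (λ x → f (j ∷ x)))) (sum-cong-≗ (λ j → *-distribˡ-∑Vec n c (λ x → f (j ∷ x))))

  ∑Vec-∑ : ∀ n {K} (f : Fin K → Vec (Fin M) n → ℕ) →
    ∑Vec n (λ x → ∑[ s < K ] f s x) ≡ ∑[ s < K ] ∑Vec n (f s)
  ∑Vec-∑ zero f = refl
  ∑Vec-∑ (suc n) f =
    trans (sum-cong-≗ (λ j → ∑Vec-∑ n (λ s x → f s (j ∷ x)))) (∑-comm (λ j s → ∑Vec n (λ x → f s (j ∷ x))))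

  ∏∑-expand : ∀ r (P : Fin r → Fin M → ℕ) →
    ∏[ t < r ] ∑[ j < M ] P t j ≡ ∑Vec r (λ J → ∏[ t < r ] P t (lookup J t))
  ∏∑-expand zero P = refl
  ∏∑-expand (suc r) P = begin
    (∑[ j < M ] P zero j) * ∏[ t < r ] ∑[ j < M ] P (suc t) j
      ≡⟨ cong ((∑[ j < M ] P zero j) *_) (∏∑-expand r (P ∘ suc)) ⟩
    (∑[ j < M ] P zero j) * ∑Vec r (λ J → ∏[ t < r ] P (suc t) (lookup J t))
      ≡⟨ *-distribʳ-sum (∑Vec r (λ J → ∏[ t < r ] P (suc t) (lookup J t))) (P zero) ⟩
    ∑[ j < M ] (P zero j * ∑Vec r (λ J → ∏[ t < r ] P (suc t) (lookup J t)))
      ≡⟨ sum-cong-≗ (λ j → *-distribˡ-∑Vec r (P zero j) _) ⟩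
    ∑[ j < M ] ∑Vec r (λ J → P zero j * ∏[ t < r ] P (suc t) (lookup J t))
      ∎
    where open ≡-Reasoning

merge : ∀ {A : Set} {n} → (Fin n → Bool) → Vec A n → Vec A n → Vec A n
merge S y x = tabulate (λ i → if S i then lookup y i else lookup x i)

lookup-merge-true : ∀ {A : Set} {n} (S : Fin n → Bool) (y x : Vec A n) {i} → S i ≡ true → lookup (merge S y x) i ≡ lookup y i
lookup-merge-true S y x {i} Si = trans (lookup∘tabulate _ i) (cong (λ s → if s then lookup y i else lookup x i) Si)

lookup-merge-false : ∀ {A : Set} {n} (S : Fin n → Bool) (y x : Vec A n) {i} → S i ≡ false → lookup (merge S y x) i ≡ lookup x i
lookup-merge-false S y x {i} Si = trans (lookup∘tabulate _ i) (cong (λ s → if s then lookup y i else lookup x i) Si)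

module _ {M : ℕ} (d : Fin M) where

  ∑If : Bool → (Fin M → ℕ) → ℕ
  ∑If true g = ∑[ j < M ] g j
  ∑If false g = g d

  -- The sum over all tuples that agree with d outside S.
  ∑On : ∀ {n} → (Fin n → Bool) → (Vec (Fin M) n → ℕ) → ℕ
  ∑On {zero} S f = f []
  ∑On {suc n} S f = ∑If (S zero) (λ j → ∑On (S ∘ suc) (λ x → f (j ∷ x)))

  ∑If-cong : ∀ s {g h : Fin M → ℕ} → (∀ j → g j ≡ h j) → ∑If s g ≡ ∑If s h
  ∑If-cong true g≡h = sum-cong-≗ g≡h
  ∑If-cong false g≡h = g≡h d

  *-distribˡ-∑If : ∀ s c (g : Fin M → ℕ) → c * ∑If s g ≡ ∑If s (λ j → c * g j)
  *-distribˡ-∑If true c g = *-distribˡ-sum c g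
  *-distribˡ-∑If false c g = refl

  ∑If-distrib-+ : ∀ s (g h : Fin M → ℕ) → ∑If s (λ j → g j + h j) ≡ ∑If s g + ∑If s h
  ∑If-distrib-+ true g h = ∑-distrib-+ g h
  ∑If-distrib-+ false g h = refl

  ∑If-∑ : ∀ s {K} (f : Fin M → Fin K → ℕ) → ∑If s (λ j → ∑[ k < K ] f j k) ≡ ∑[ k < K ] ∑If s (λ j → f j k)
  ∑If-∑ true f = ∑-comm f
  ∑If-∑ false f = refl

  ∑On-cong : ∀ {n} (S : Fin n → Bool) {f g : Vec (Fin M) n → ℕ} → (∀ x → f x ≡ g x) → ∑On S f ≡ ∑On S g
  ∑On-cong {zero} S f≡g = f≡g []
  ∑On-cong {suc n} S f≡g = ∑If-cong (S zero) (λ j → ∑On-cong (S ∘ suc) (λ x → f≡g (j ∷ x)))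

  *-distribˡ-∑On : ∀ {n} (S : Fin n → Bool) c (f : Vec (Fin M) n → ℕ) → c * ∑On S f ≡ ∑On S (λ x → c * f x)
  *-distribˡ-∑On {zero} S c f = refl
  *-distribˡ-∑On {suc n} S c f = trans (*-distribˡ-∑If (S zero) c _)
    (∑If-cong (S zero) (λ j → *-distribˡ-∑On (S ∘ suc) c (λ x → f (j ∷ x))))

  ∑On-distrib-+ : ∀ {n} (S : Fin n → Bool) (f g : Vec (Fin M) n → ℕ) → ∑On S (λ x → f x + g x) ≡ ∑On S f + ∑On S g
  ∑On-distrib-+ {zero} S f g = refl
  ∑On-distrib-+ {suc n} S f g = trans (∑If-cong (S zero) (λ j → ∑On-distrib-+ (S ∘ suc) (λ x → f (j ∷ x)) (λ x → g (j ∷ x))))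
    (∑If-distrib-+ (S zero) _ _)

  ∑On-∑ : ∀ {n} (S : Fin n → Bool) {K} (f : Fin K → Vec (Fin M) n → ℕ) →
    ∑On S (λ x → ∑[ k < K ] f k x) ≡ ∑[ k < K ] ∑On S (f k)
  ∑On-∑ {zero} S f = refl
  ∑On-∑ {suc n} S f = trans (∑If-cong (S zero) (λ j → ∑On-∑ (S ∘ suc) (λ k x → f k (j ∷ x))))
    (∑If-∑ (S zero) (λ j k → ∑On (S ∘ suc) (λ x → f k (j ∷ x))))

  ∑If-∑On : ∀ s {n} (S : Fin n → Bool) (f : Fin M → Vec (Fin M) n → ℕ) →
    ∑If s (λ j → ∑On S (f j)) ≡ ∑On S (λ x → ∑If s (λ j → f j x))
  ∑If-∑On true S f = sym (∑On-∑ S (λ j → f j))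
  ∑If-∑On false S f = refl

  ∑On-frozen : ∀ n (f : Vec (Fin M) n → ℕ) → ∑On (λ (_ : Fin n) → false) f ≡ f (replicate n d)
  ∑On-frozen zero f = refl
  ∑On-frozen (suc n) f = ∑On-frozen n (λ x → f (d ∷ x))

  ∑Vec-split : ∀ {n} (S : Fin n → Bool) (f : Vec (Fin M) n → ℕ) →
    ∑Vec n f ≡ ∑On (not ∘ S) (λ x → ∑On S (λ y → f (merge S y x)))
  ∑Vec-split {zero} S f = refl
  ∑Vec-split {suc n} S f with S zero
  ... | true = trans (sum-cong-≗ (λ j → ∑Vec-split (S ∘ suc) (λ x → f (j ∷ x))))
    (∑If-∑On true (not ∘ S ∘ suc) (λ j x → ∑On (S ∘ suc) (λ y → f (j ∷ merge (S ∘ suc) y x))))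
  ... | false = sum-cong-≗ (λ k → ∑Vec-split (S ∘ suc) (λ x → f (k ∷ x)))

  ∑On-∏On : ∀ {n} (S : Fin n → Bool) (φ : Fin n → Fin M → ℕ) →
    ∑On S (λ y → ∏On S (λ i → φ i (lookup y i))) ≡ ∏On S (λ i → ∑[ j < M ] φ i j)
  ∑On-∏On {zero} S φ = refl
  ∑On-∏On {suc n} S φ with S zero
  ... | true = begin
    ∑[ j < M ] ∑On (S ∘ suc) (λ y → φ zero j * ∏On (S ∘ suc) (λ i → φ (suc i) (lookup y i)))
      ≡⟨ sum-cong-≗ (λ j → sym (*-distribˡ-∑On (S ∘ suc) (φ zero j) _)) ⟩
    ∑[ j < M ] (φ zero j * ∑On (S ∘ suc) (λ y → ∏On (S ∘ suc) (λ i → φ (suc i) (lookup y i))))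
      ≡⟨ sym (*-distribʳ-sum _ (φ zero)) ⟩
    (∑[ j < M ] φ zero j) * ∑On (S ∘ suc) (λ y → ∏On (S ∘ suc) (λ i → φ (suc i) (lookup y i)))
      ≡⟨ cong ((∑[ j < M ] φ zero j) *_) (∑On-∏On (S ∘ suc) (φ ∘ suc)) ⟩
    (∑[ j < M ] φ zero j) * ∏On (S ∘ suc) (λ i → ∑[ j < M ] φ (suc i) j)
      ∎
    where open ≡-Reasoning
  ... | false = trans (∑On-cong (S ∘ suc) (λ y → +-identityʳ _)) (trans (∑On-∏On (S ∘ suc) (φ ∘ suc)) (sym (+-identityʳ _)))

  fill : ∀ {n} → (Fin n → Bool) → Fin M → Vec (Fin M) n
  fill S w = tabulate (λ i → if S i then w else d)

  lookup-fill : ∀ {n} (S : Fin n → Bool) w {i} → S i ≡ true → lookup (fill S w) i ≡ w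
  lookup-fill S w {i} Si = trans (lookup∘tabulate _ i) (cong (λ s → if s then w else d) Si)

  ∑On-δ : ∀ {n} (S : Fin n → Bool) w (φ : Vec (Fin M) n → ℕ) →
    ∑On S (λ x → ∏On S (λ i → δ (lookup x i) w) * φ x) ≡ φ (fill S w)
  ∑On-δ {zero} S w φ = +-identityʳ _
  ∑On-δ {suc n} S w φ with S zero
  ... | true = begin
    ∑[ j < M ] ∑On (S ∘ suc) (λ x → δ j w * ∏On (S ∘ suc) (λ i → δ (lookup x i) w) * φ (j ∷ x))
      ≡⟨ sum-cong-≗ (λ j → trans (∑On-cong (S ∘ suc) (λ x → *-assoc (δ j w) _ _))
                                 (sym (*-distribˡ-∑On (S ∘ suc) (δ j w) _))) ⟩
    ∑[ j < M ] (δ j w * ∑On (S ∘ suc) (λ x → ∏On (S ∘ suc) (λ i → δ (lookup x i) w) * φ (j ∷ x)))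
      ≡⟨ ∑-δ (λ j → ∑On (S ∘ suc) (λ x → ∏On (S ∘ suc) (λ i → δ (lookup x i) w) * φ (j ∷ x))) w ⟩
    ∑On (S ∘ suc) (λ x → ∏On (S ∘ suc) (λ i → δ (lookup x i) w) * φ (w ∷ x))
      ≡⟨ ∑On-δ (S ∘ suc) w (λ x → φ (w ∷ x)) ⟩
    φ (w ∷ fill (S ∘ suc) w)
      ∎
    where open ≡-Reasoning
  ... | false = trans (∑On-cong (S ∘ suc) (λ x → cong (_* φ (d ∷ x)) (+-identityʳ (∏On (S ∘ suc) (λ i → δ (lookup x i) w)))))
    (∑On-δ (S ∘ suc) w (λ x → φ (d ∷ x)))

-- Hölder's and Finner's inequalities

module _ {A : Set} where

  rotate : ∀ {n} → Vec A n → Vec A n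
  rotate [] = []
  rotate (x ∷ xs) = xs ∷ʳ x

  rotate^ : ∀ {n} → ℕ → Vec A n → Vec A n
  rotate^ zero xs = xs
  rotate^ (suc k) xs = rotate^ k (rotate xs)

  rotate^-+ : ∀ {n} k l (xs : Vec A n) → rotate^ l (rotate^ k xs) ≡ rotate^ (k + l) xs
  rotate^-+ zero l xs = refl
  rotate^-+ (suc k) l xs = rotate^-+ k l (rotate xs)

  lookup-∷ʳ : ∀ {n} (xs : Vec A n) y (t : Fin n) → lookup (xs ∷ʳ y) (inject₁ t) ≡ lookup xs t
  lookup-∷ʳ (x ∷ xs) y zero = refl
  lookup-∷ʳ (x ∷ xs) y (suc t) = lookup-∷ʳ xs y t

  lookup≡head-rotate^ : ∀ {n} (xs : Vec A (suc n)) t → lookup xs t ≡ head (rotate^ (toℕ t) xs)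
  lookup≡head-rotate^ xs t = go (toℕ t) xs t refl
    where
      go : ∀ {n} k (xs : Vec A (suc n)) t → toℕ t ≡ k → lookup xs t ≡ head (rotate^ k xs)
      go zero (x ∷ xs) zero _ = refl
      go {suc n} (suc k) (x ∷ xs) (suc t) t≡k =
        trans (sym (lookup-∷ʳ xs x t)) (go k (xs ∷ʳ x) (inject₁ t) (trans (Fin.toℕ-inject₁ t) (suc-injective t≡k)))

  lookup-rotate^-comm : ∀ {n} (xs : Vec A (suc n)) s t →
    lookup (rotate^ (toℕ s) xs) t ≡ lookup (rotate^ (toℕ t) xs) s
  lookup-rotate^-comm xs s t = begin
    lookup (rotate^ (toℕ s) xs) t               ≡⟨ lookup≡head-rotate^ _ t ⟩
    head (rotate^ (toℕ t) (rotate^ (toℕ s) xs)) ≡⟨ cong head (rotate^-+ (toℕ s) (toℕ t) xs) ⟩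
    head (rotate^ (toℕ s + toℕ t) xs)           ≡⟨ cong (λ k → head (rotate^ k xs)) (+-comm (toℕ s) (toℕ t)) ⟩
    head (rotate^ (toℕ t + toℕ s) xs)           ≡⟨ sym (cong head (rotate^-+ (toℕ t) (toℕ s) xs)) ⟩
    head (rotate^ (toℕ s) (rotate^ (toℕ t) xs)) ≡⟨ sym (lookup≡head-rotate^ _ s) ⟩
    lookup (rotate^ (toℕ t) xs) s               ∎
    where open ≡-Reasoning

  ∏-lookup-∷ʳ : ∀ {n} (g : A → ℕ) (xs : Vec A n) y →
    ∏[ t < suc n ] g (lookup (xs ∷ʳ y) t) ≡ g y * ∏[ t < n ] g (lookup xs t)
  ∏-lookup-∷ʳ g [] y = refl
  ∏-lookup-∷ʳ g (x ∷ xs) y = trans (cong (g x *_) (∏-lookup-∷ʳ g xs y)) (x∙yz≈y∙xz (g x) (g y) _)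

  ∏-lookup-rotate^ : ∀ {n} k (g : A → ℕ) (xs : Vec A n) →
    ∏[ t < n ] g (lookup (rotate^ k xs) t) ≡ ∏[ t < n ] g (lookup xs t)
  ∏-lookup-rotate^ zero g xs = refl
  ∏-lookup-rotate^ (suc k) g [] = refl
  ∏-lookup-rotate^ (suc k) g (x ∷ xs) = trans (∏-lookup-rotate^ k g (xs ∷ʳ x)) (∏-lookup-∷ʳ g xs x)

∏-rotations : ∀ {M r} (P : Vec (Fin M → ℕ) (suc r)) (J : Vec (Fin M) (suc r)) →
  ∏[ s < suc r ] ∏[ t < suc r ] lookup (rotate^ (toℕ s) P) t (lookup J t)
    ≡ ∏[ k < suc r ] ∏[ t < suc r ] lookup P t (lookup J k)
∏-rotations {r = r} P J = begin
  ∏[ s < suc r ] ∏[ t < suc r ] lookup (rotate^ (toℕ s) P) t (lookup J t)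
    ≡⟨ ∏-comm {suc r} {suc r} (λ s t → lookup (rotate^ (toℕ s) P) t (lookup J t)) ⟩
  ∏[ t < suc r ] ∏[ s < suc r ] lookup (rotate^ (toℕ s) P) t (lookup J t)
    ≡⟨ ∏-cong (λ t → ∏-cong (λ s → cong (λ Q → Q (lookup J t)) (lookup-rotate^-comm P s t))) ⟩
  ∏[ t < suc r ] ∏[ s < suc r ] lookup (rotate^ (toℕ t) P) s (lookup J t)
    ≡⟨ ∏-cong (λ t → ∏-lookup-rotate^ (toℕ t) (λ Q → Q (lookup J t)) P) ⟩
  ∏[ t < suc r ] ∏[ s < suc r ] lookup P s (lookup J t)
    ∎
  where open ≡-Reasoning

∑Vec-rotate^ : ∀ {M r} k (P : Vec (Fin M → ℕ) r) →
  ∑Vec r (λ J → ∏[ t < r ] lookup (rotate^ k P) t (lookup J t)) ≡ ∏[ t < r ] ∑[ j < M ] lookup P t j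
∑Vec-rotate^ {M} {r} k P =
  trans (sym (∏∑-expand r (lookup (rotate^ k P)))) (∏-lookup-rotate^ k (λ Q → ∑[ j < M ] Q j) P)

-- AM–GM over the r cyclic shifts X s of the family: for each J their product is
-- ∏_k ∏_t P t (J k), while each shift sums over J to ∏_t ∑_j P t j.
hölder : ∀ {M r} .{{_ : NonZero r}} (P : Vec (Fin M → ℕ) r) (L : Fin M → ℕ) C →
  (∀ j → L j ^ r ≤ C * ∏[ t < r ] lookup P t j) →
  (∑[ j < M ] L j) ^ r ≤ C * ∏[ t < r ] ∑[ j < M ] lookup P t j
hölder {M} {r@(suc _)} P L C L^r≤ = *-cancelˡ-≤ r (begin
  r * (∑[ j < M ] L j) ^ r              ≡⟨ cong (r *_) (trans (sym (∏-const r (∑[ j < M ] L j))) (∏∑-expand r (λ _ → L))) ⟩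
  r * ∑Vec r ∏L                         ≡⟨ *-distribˡ-∑Vec r r ∏L ⟩
  ∑Vec r (λ J → r * ∏L J)               ≤⟨ ∑Vec-mono-≤ r amgm-rotations ⟩
  ∑Vec r (λ J → C * ∑[ s < r ] X s J)   ≡⟨ sym (*-distribˡ-∑Vec r C (λ J → ∑[ s < r ] X s J)) ⟩
  C * ∑Vec r (λ J → ∑[ s < r ] X s J)   ≡⟨ cong (C *_) (trans (∑Vec-∑ r X) (sum-cong-≗ {r} (λ s → ∑Vec-rotate^ (toℕ s) P))) ⟩
  C * ∑[ s < r ] ∏∑P                    ≡⟨ cong (C *_) (∑-const r ∏∑P) ⟩
  C * (r * ∏∑P)                         ≡⟨ x∙yz≈y∙xz C r ∏∑P ⟩
  r * (C * ∏∑P)                         ∎)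
  where
    open ≤-Reasoning
    ∏∑P = ∏[ t < r ] ∑[ j < M ] lookup P t j

    ∏L : Vec (Fin M) r → ℕ
    ∏L J = ∏[ k < r ] L (lookup J k)

    X : Fin r → Vec (Fin M) r → ℕ
    X s J = ∏[ t < r ] lookup (rotate^ (toℕ s) P) t (lookup J t)

    amgm-rotations : ∀ J → r * ∏L J ≤ C * ∑[ s < r ] X s J
    amgm-rotations J = ^-cancelʳ-≤ r (begin
      (r * ∏L J) ^ r
        ≡⟨ trans (^-distribʳ-* r (∏L J) r) (cong (r ^ r *_) (sym (∏-^ r (λ k → L (lookup J k))))) ⟩
      r ^ r * ∏[ k < r ] (L (lookup J k) ^ r)
        ≤⟨ *-monoʳ-≤ (r ^ r) (∏-mono-≤ (λ k → L^r≤ (lookup J k))) ⟩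
      r ^ r * ∏[ k < r ] (C * ∏[ t < r ] lookup P t (lookup J k))
        ≡⟨ cong (r ^ r *_) (trans (∏-distrib-* {r} (λ _ → C) (λ k → ∏[ t < r ] lookup P t (lookup J k)))
                                  (cong₂ _*_ (∏-const r C) (sym (∏-rotations P J)))) ⟩
      r ^ r * (C ^ r * ∏[ s < r ] X s J)
        ≡⟨ x∙yz≈y∙xz (r ^ r) (C ^ r) _ ⟩
      C ^ r * (r ^ r * ∏[ s < r ] X s J)
        ≤⟨ *-monoʳ-≤ (C ^ r) (amgm r (λ s → X s J)) ⟩
      C ^ r * (∑[ s < r ] X s J) ^ r
        ≡⟨ sym (^-distribʳ-* C _ r) ⟩
      (C * ∑[ s < r ] X s J) ^ r
        ∎)

select : ∀ {A : Set} {N} (T : Fin N → Bool) → (Fin N → A) → Vec A ∣ T ∣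
select {N = zero} T P = []
select {N = suc N} T P with T zero
... | true = P zero ∷ select (T ∘ suc) (P ∘ suc)
... | false = select (T ∘ suc) (P ∘ suc)

∏-select : ∀ {A : Set} {N} (T : Fin N → Bool) (P : Fin N → A) (g : A → ℕ) →
  ∏[ t < ∣ T ∣ ] g (lookup (select T P) t) ≡ ∏On T (λ b → g (P b))
∏-select {N = zero} T P g = refl
∏-select {N = suc N} T P g with T zero
... | true = cong (g (P zero) *_) (∏-select (T ∘ suc) (P ∘ suc) g)
... | false = trans (∏-select (T ∘ suc) (P ∘ suc) g) (sym (+-identityʳ _))

DependsOnlyOn : ∀ {M n} → (Fin n → Bool) → (Vec (Fin M) n → ℕ) → Set
DependsOnlyOn S f = ∀ x y → (∀ i → S i ≡ true → lookup x i ≡ lookup y i) → f x ≡ f y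

module _ {M : ℕ} (d : Fin M) where

  hölder-masked : ∀ {N r} .{{_ : NonZero r}} (T : Fin N → Bool) (P : Fin N → Fin M → ℕ) (L : Fin M → ℕ) →
    ∣ T ∣ ≡ r → (∀ b → T b ≡ false → ∀ j → P b j ≡ P b d) →
    (∀ j → L j ^ r ≤ ∏[ b < N ] P b j) →
    (∑[ j < M ] L j) ^ r ≤ ∏[ b < N ] ∑If d (T b) (P b)
  hölder-masked {N} T P L refl frozen L^r≤ =
    subst ((∑[ j < M ] L j) ^ ∣ T ∣ ≤_) conclusion (hölder (select T P) L C bound)
    where
      C = ∏On (not ∘ T) (λ b → P b d)

      ∏-active : ∀ (g : Fin N → ℕ) → ∏[ b < N ] (if T b then g b else P b d) ≡ C * ∏On T g
      ∏-active g = trans (∏-if T g (λ b → P b d)) (*-comm (∏On T g) C)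

      bound : ∀ j → L j ^ ∣ T ∣ ≤ C * ∏[ t < ∣ T ∣ ] lookup (select T P) t j
      bound j = ≤-trans (L^r≤ j) (≤-reflexive (begin
        ∏[ b < N ] P b j                              ≡⟨ ∏-cong (λ b → frozen-if b (T b) refl) ⟩
        ∏[ b < N ] (if T b then P b j else P b d)     ≡⟨ ∏-active (λ b → P b j) ⟩
        C * ∏On T (λ b → P b j)                       ≡⟨ cong (C *_) (sym (∏-select T P (λ Q → Q j))) ⟩
        C * ∏[ t < ∣ T ∣ ] lookup (select T P) t j    ∎))
        where
          open ≡-Reasoning
          frozen-if : ∀ b s → T b ≡ s → P b j ≡ (if s then P b j else P b d)
          frozen-if b true _ = refl
          frozen-if b false Tb≡false = frozen b Tb≡false j

      conclusion : C * ∏[ t < ∣ T ∣ ] ∑[ j < M ] lookup (select T P) t j ≡ ∏[ b < N ] ∑If d (T b) (P b)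
      conclusion = begin
        C * ∏[ t < ∣ T ∣ ] ∑[ j < M ] lookup (select T P) t j    ≡⟨ cong (C *_) (∏-select T P (λ Q → ∑[ j < M ] Q j)) ⟩
        C * ∏On T (λ b → ∑[ j < M ] P b j)                       ≡⟨ sym (∏-active (λ b → ∑[ j < M ] P b j)) ⟩
        ∏[ b < N ] (if T b then ∑[ j < M ] P b j else P b d)     ≡⟨ ∏-cong (λ b → ∑If-if (T b) (P b)) ⟩
        ∏[ b < N ] ∑If d (T b) (P b)                             ∎
        where
          open ≡-Reasoning
          ∑If-if : ∀ s g → (if s then ∑[ j < M ] g j else g d) ≡ ∑If d s g
          ∑If-if true g = refl
          ∑If-if false g = refl

  -- Induction on the coordinates: summing out a free coordinate is Hölder's inequality
  -- for the r factors that depend on it.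
  finner : ∀ {n N r} .{{_ : NonZero r}} (a : Fin n → Bool) (S : Fin N → Fin n → Bool)
    (H : Fin N → Vec (Fin M) n → ℕ) (L : Vec (Fin M) n → ℕ) →
    (∀ b i → S b i ≡ true → a i ≡ true) →
    (∀ i → a i ≡ true → ∑[ b < N ] ⌊ S b i ⌋ ≡ r) →
    (∀ b → DependsOnlyOn (S b) (H b)) →
    (∀ x → L x ^ r ≤ ∏[ b < N ] H b x) →
    ∑On d a L ^ r ≤ ∏[ b < N ] ∑On d (S b) (H b)
  finner {zero} a S H L _ _ _ L^r≤ = L^r≤ []
  finner {suc n} {N} {r} a S H L S⊆a cover dep L^r≤ with a zero in a₀
  ... | false = subst (∑On d (a ∘ suc) (λ x → L (d ∷ x)) ^ r ≤_) (∏-cong frozen)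
    (finner (a ∘ suc) (λ b → S b ∘ suc) (λ b x → H b (d ∷ x)) (λ x → L (d ∷ x))
      (λ b i → S⊆a b (suc i)) (cover ∘ suc)
      (λ b x y agree → dep b (d ∷ x) (d ∷ y) λ { zero _ → refl ; (suc i) → agree i })
      (λ x → L^r≤ (d ∷ x)))
    where
      frozen : ∀ b → ∑On d (S b ∘ suc) (λ x → H b (d ∷ x)) ≡ ∑On d (S b) (H b)
      frozen b = cong (λ s → ∑If d s (λ j → ∑On d (S b ∘ suc) (λ x → H b (j ∷ x))))
        (sym (¬-not (λ Sb₀ → contradiction (trans (sym a₀) (S⊆a b zero Sb₀)) λ ())))
  ... | true = subst₂ (λ u v → u ^ r ≤ v) (sym (∑If-∑On d true (a ∘ suc) (λ j x → L (j ∷ x))))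
    (∏-cong (λ b → sym (∑If-∑On d (S b zero) (S b ∘ suc) (λ j x → H b (j ∷ x)))))
    (finner (a ∘ suc) (λ b → S b ∘ suc) H′ L′ (λ b i → S⊆a b (suc i)) (cover ∘ suc) H′-depends hölder-step)
    where
      L′ : Vec (Fin M) n → ℕ
      L′ x = ∑[ j < M ] L (j ∷ x)

      H′ : Fin N → Vec (Fin M) n → ℕ
      H′ b x = ∑If d (S b zero) (λ j → H b (j ∷ x))

      H′-depends : ∀ b → DependsOnlyOn (S b ∘ suc) (H′ b)
      H′-depends b x y agree = ∑If-cong d (S b zero) (λ j → dep b (j ∷ x) (j ∷ y) λ { zero _ → refl ; (suc i) → agree i })

      hölder-step : ∀ x → L′ x ^ r ≤ ∏[ b < N ] H′ b x
      hölder-step x = hölder-masked (λ b → S b zero) (λ b j → H b (j ∷ x)) (λ j → L (j ∷ x)) (cover zero a₀)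
        constant-if-inactive (λ j → L^r≤ (j ∷ x))
        where
          constant-if-inactive : ∀ b → S b zero ≡ false → ∀ j → H b (j ∷ x) ≡ H b (d ∷ x)
          constant-if-inactive b Sb₀≡false j = dep b (j ∷ x) (d ∷ x)
            λ { zero Sb₀ → contradiction (trans (sym Sb₀) Sb₀≡false) λ () ; (suc i) _ → refl }

-- Common neighbours in C4-free graphs

module _ {m} (G : Graph m) where

  Adj⇒≢ : ∀ {u v} → Adj G u v → u ≢ v
  Adj⇒≢ {u} a refl = contradiction (trans (sym a) (irrefl G u)) λ ()

  deg≡∑ : ∀ v → deg G v ≡ ∑[ u < m ] ⌊ adj G v u ⌋
  deg≡∑ v = ΣV≡∑ m _

  edges≡∑∑ : edges G ≡ ∑[ u < m ] ∑[ v < m ] (⌊ adj G u v ⌋ * ⌊ toℕ u <ᵇ toℕ v ⌋)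
  edges≡∑∑ = trans (ΣV≡∑ m _) (sum-cong-≗ (λ u → ΣV≡∑ m (λ v → ⌊ adj G u v ⌋ * ⌊ toℕ u <ᵇ toℕ v ⌋)))

  handshake : ∑[ v < m ] deg G v ≡ 2 * edges G
  handshake = begin
    ∑[ v < m ] deg G v
      ≡⟨ sum-cong-≗ deg≡∑ ⟩
    ∑[ u < m ] ∑[ v < m ] ⌊ adj G u v ⌋
      ≡⟨ ∑∑-upper-triangle (λ u v → ⌊ adj G u v ⌋) (λ u → cong ⌊_⌋ (irrefl G u)) ⟩
    ∑[ u < m ] ∑[ v < m ] ((⌊ adj G u v ⌋ + ⌊ adj G v u ⌋) * lt u v)
      ≡⟨ sum-cong-≗ (λ u → trans (sum-cong-≗ (λ v → twice u v)) (∑-distrib-+ {m} _ _)) ⟩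
    ∑[ u < m ] (∑[ v < m ] (⌊ adj G u v ⌋ * lt u v) + ∑[ v < m ] (⌊ adj G u v ⌋ * lt u v))
      ≡⟨ ∑-distrib-+ {m} _ _ ⟩
    E + E
      ≡⟨ sym (trans (cong (2 *_) edges≡∑∑) (cong (E +_) (+-identityʳ E))) ⟩
    2 * edges G
      ∎
    where
      open ≡-Reasoning
      lt : Fin m → Fin m → ℕ
      lt u v = ⌊ toℕ u <ᵇ toℕ v ⌋
      E = ∑[ u < m ] ∑[ v < m ] (⌊ adj G u v ⌋ * lt u v)
      twice : ∀ u v → (⌊ adj G u v ⌋ + ⌊ adj G v u ⌋) * lt u v ≡ ⌊ adj G u v ⌋ * lt u v + ⌊ adj G u v ⌋ * lt u v
      twice u v = trans (cong (λ a → (⌊ adj G u v ⌋ + ⌊ a ⌋) * lt u v) (adj-sym G v u))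
                        (*-distribʳ-+ (lt u v) ⌊ adj G u v ⌋ ⌊ adj G u v ⌋)

  common-neighbours-C4Free : C4Free G → ∀ {j₁ j₂ u v} → j₁ ≢ j₂ →
    Adj G j₁ u → Adj G j₂ u → Adj G j₁ v → Adj G j₂ v → u ≡ v
  common-neighbours-C4Free c4 {j₁} {j₂} {u} {v} j₁≢j₂ a₁ a₂ b₁ b₂ with u Fin.≟ v
  ... | yes u≡v = u≡v
  ... | no u≢v = contradiction (cycle , (λ {x} {y} → injective {x} {y}) , steps , a₂) c4
    where
      cycle : Fin 4 → Fin m
      cycle zero = u
      cycle (suc zero) = j₁
      cycle (suc (suc zero)) = v
      cycle (suc (suc (suc zero))) = j₂

      injective : ∀ {x y} → cycle x ≡ cycle y → x ≡ y
      injective {zero} {zero} _ = refl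
      injective {zero} {suc zero} e = contradiction (sym e) (Adj⇒≢ a₁)
      injective {zero} {suc (suc zero)} e = contradiction e u≢v
      injective {zero} {suc (suc (suc zero))} e = contradiction (sym e) (Adj⇒≢ a₂)
      injective {suc zero} {zero} e = contradiction e (Adj⇒≢ a₁)
      injective {suc zero} {suc zero} _ = refl
      injective {suc zero} {suc (suc zero)} e = contradiction e (Adj⇒≢ b₁)
      injective {suc zero} {suc (suc (suc zero))} e = contradiction e j₁≢j₂
      injective {suc (suc zero)} {zero} e = contradiction (sym e) u≢v
      injective {suc (suc zero)} {suc zero} e = contradiction (sym e) (Adj⇒≢ b₁)
      injective {suc (suc zero)} {suc (suc zero)} _ = refl
      injective {suc (suc zero)} {suc (suc (suc zero))} e = contradiction (sym e) (Adj⇒≢ b₂)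
      injective {suc (suc (suc zero))} {zero} e = contradiction e (Adj⇒≢ a₂)
      injective {suc (suc (suc zero))} {suc zero} e = contradiction (sym e) j₁≢j₂
      injective {suc (suc (suc zero))} {suc (suc zero)} e = contradiction e (Adj⇒≢ b₂)
      injective {suc (suc (suc zero))} {suc (suc (suc zero))} _ = refl

      steps : ∀ (i : Fin 3) → Adj G (cycle (inject₁ i)) (cycle (suc i))
      steps zero = trans (adj-sym G u j₁) a₁
      steps (suc zero) = b₁
      steps (suc (suc zero)) = trans (adj-sym G v j₂) b₂

  commonNeighbours : ∀ {n} → (Fin n → Bool) → Vec (Fin m) n → ℕ
  commonNeighbours S x = ∑[ j < m ] ∏On S (λ i → ⌊ adj G j (lookup x i) ⌋)

  -- For nonempty S this is 1 if x is constant on S and 0 otherwise.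
  constantValues : ∀ {n} → (Fin n → Bool) → Vec (Fin m) n → ℕ
  constantValues S x = ∑[ w < m ] ∏On S (λ i → δ (lookup x i) w)

  constantValues≤1 : ∀ {n} (S : Fin n → Bool) x → 1 ≤ ∣ S ∣ → constantValues S x ≤ 1
  constantValues≤1 S x 1≤∣S∣ = let (i , Si) = member-of-nonempty S 1≤∣S∣ in begin
    ∑[ w < m ] ∏On S (λ i → δ (lookup x i) w)  ≤⟨ ∑-mono-≤ (λ w → ∏On≤factor S (λ i → δ≤1 (lookup x i) w) Si) ⟩
    ∑[ w < m ] δ (lookup x i) w                 ≡⟨ ∑-δʳ (lookup x i) ⟩
    1                                           ∎
    where open ≤-Reasoning

  -- Two distinct common neighbours of the x_i force all of them to coincide.
  constantValues-pos : C4Free G → ∀ {n} (S : Fin n → Bool) x → 1 ≤ ∣ S ∣ →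
    2 ≤ commonNeighbours S x → 1 ≤ constantValues S x
  constantValues-pos c4 S x 1≤∣S∣ 2≤cn =
    let (i₀ , Si₀) = member-of-nonempty S 1≤∣S∣
        (j₁ , j₂ , j₁≢j₂ , p₁ , p₂) = two-positive-terms (λ j → ∏On S (λ i → ⌊ adj G j (lookup x i) ⌋))
                                        (λ j → ∏On≤1 S (λ i → ⌊⌋≤1 (adj G j (lookup x i)))) 2≤cn
        adjacent : ∀ {j} → 1 ≤ ∏On S (λ i → ⌊ adj G j (lookup x i) ⌋) → ∀ {i} → S i ≡ true → Adj G j (lookup x i)
        adjacent {j} p Si = ⌊⌋-pos (≤-trans p (∏On≤factor S (λ i → ⌊⌋≤1 (adj G j (lookup x i))) Si))
        constant : ∀ i → S i ≡ true → δ (lookup x i) (lookup x i₀) ≡ 1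
        constant i Si = trans (cong (λ u → δ u (lookup x i₀))
          (common-neighbours-C4Free c4 j₁≢j₂ (adjacent p₁ Si) (adjacent p₂ Si) (adjacent p₁ Si₀) (adjacent p₂ Si₀)))
          (δ-refl (lookup x i₀))
    in subst (_≤ constantValues S x) (∏On-ones S constant) (term≤∑ (λ w → ∏On S (λ i → δ (lookup x i) w)) (lookup x i₀))

  commonNeighbours-identity : C4Free G → ∀ {n k} (S : Fin n → Bool) x → ∣ S ∣ ≡ suc k →
    commonNeighbours S x ^ suc k + constantValues S x * commonNeighbours S x
      ≡ commonNeighbours S x + constantValues S x * commonNeighbours S x ^ suc k
  commonNeighbours-identity c4 {k = k} S x ∣S∣≡1+k
    with constantValues S x | constantValues≤1 S x 1≤∣S∣ | constantValues-pos c4 S x 1≤∣S∣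
    where
      1≤∣S∣ : 1 ≤ ∣ S ∣
      1≤∣S∣ = subst (1 ≤_) (sym ∣S∣≡1+k) (s≤s z≤n)
  ... | 1 | _ | _ = swap (commonNeighbours S x ^ suc k) (commonNeighbours S x)
    where
      swap : ∀ a b → a + 1 * b ≡ b + 1 * a
      swap = solve-∀
  ... | suc (suc _) | s≤s () | _
  ... | 0 | _ | 2≤cn⇒pos with commonNeighbours S x
  ...   | 0 = refl
  ...   | 1 = cong (_+ 0) (^-zeroˡ (suc k))
  ...   | suc (suc _) = contradiction (2≤cn⇒pos (s≤s (s≤s z≤n))) λ ()

module _ {m} (G : Graph m) (d : Fin m) where

  ∑On-commonNeighbours : ∀ {n} (S : Fin n → Bool) → ∑On d S (commonNeighbours G S) ≡ ∑[ j < m ] (deg G j ^ ∣ S ∣)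
  ∑On-commonNeighbours S = begin
    ∑On d S (λ x → ∑[ j < m ] ∏On S (λ i → ⌊ adj G j (lookup x i) ⌋))
      ≡⟨ ∑On-∑ d S (λ j x → ∏On S (λ i → ⌊ adj G j (lookup x i) ⌋)) ⟩
    ∑[ j < m ] ∑On d S (λ x → ∏On S (λ i → ⌊ adj G j (lookup x i) ⌋))
      ≡⟨ sum-cong-≗ (λ j → ∑On-∏On d S (λ i u → ⌊ adj G j u ⌋)) ⟩
    ∑[ j < m ] ∏On S (λ i → ∑[ u < m ] ⌊ adj G j u ⌋)
      ≡⟨ sum-cong-≗ (λ j → trans (∏On-const S _) (cong (_^ ∣ S ∣) (sym (deg≡∑ G j)))) ⟩
    ∑[ j < m ] (deg G j ^ ∣ S ∣)
      ∎
    where open ≡-Reasoning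

  ∑On-constantValues : ∀ {n} (S : Fin n → Bool) (φ : Vec (Fin m) n → ℕ) →
    ∑On d S (λ x → constantValues G S x * φ x) ≡ ∑[ w < m ] φ (fill d S w)
  ∑On-constantValues S φ = trans (∑On-cong d S (λ x → *-distribʳ-sum (φ x) (λ w → ∏On S (λ i → δ (lookup x i) w))))
    (trans (∑On-∑ d S (λ w x → ∏On S (λ i → δ (lookup x i) w) * φ x)) (sum-cong-≗ (λ w → ∑On-δ d S w φ)))

  commonNeighbours-fill : ∀ {n k} (S : Fin n → Bool) → ∣ S ∣ ≡ suc k → ∀ w → commonNeighbours G S (fill d S w) ≡ deg G w
  commonNeighbours-fill {k = k} S ∣S∣≡1+k w = trans (sum-cong-≗ adjacent-to-w) (sym (deg≡∑ G w))
    where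
      open ≡-Reasoning
      adjacent-to-w : ∀ j → ∏On S (λ i → ⌊ adj G j (lookup (fill d S w) i) ⌋) ≡ ⌊ adj G w j ⌋
      adjacent-to-w j = begin
        ∏On S (λ i → ⌊ adj G j (lookup (fill d S w) i) ⌋)
          ≡⟨ ∏On-cong S (λ i Si → cong (λ u → ⌊ adj G j u ⌋) (lookup-fill d S w Si)) ⟩
        ∏On S (λ _ → ⌊ adj G j w ⌋)
          ≡⟨ trans (∏On-const S _) (cong (⌊ adj G j w ⌋ ^_) ∣S∣≡1+k) ⟩
        ⌊ adj G j w ⌋ ^ suc k
          ≡⟨ trans (⌊⌋-^ _ k) (cong ⌊_⌋ (adj-sym G j w)) ⟩
        ⌊ adj G w j ⌋
          ∎

  ∑On-commonNeighbours^+∑deg : C4Free G → ∀ {n k} (S : Fin n → Bool) → ∣ S ∣ ≡ suc k →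
    ∑On d S (λ x → commonNeighbours G S x ^ suc k) + ∑[ w < m ] deg G w
      ≡ ∑[ w < m ] (deg G w ^ suc k) + ∑[ w < m ] (deg G w ^ suc k)
  ∑On-commonNeighbours^+∑deg c4 {k = k} S ∣S∣≡1+k = begin
    ∑On d S (λ x → cn x ^ suc k) + ∑[ w < m ] deg G w
      ≡⟨ cong (∑On d S (λ x → cn x ^ suc k) +_) ∑deg ⟩
    ∑On d S (λ x → cn x ^ suc k) + ∑On d S (λ x → κ x * cn x)
      ≡⟨ sym (∑On-distrib-+ d S _ _) ⟩
    ∑On d S (λ x → cn x ^ suc k + κ x * cn x)
      ≡⟨ ∑On-cong d S (λ x → commonNeighbours-identity G c4 S x ∣S∣≡1+k) ⟩
    ∑On d S (λ x → cn x + κ x * cn x ^ suc k)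
      ≡⟨ ∑On-distrib-+ d S _ _ ⟩
    ∑On d S cn + ∑On d S (λ x → κ x * cn x ^ suc k)
      ≡⟨ cong₂ _+_ ∑cn ∑κcn^ ⟩
    ∑[ w < m ] (deg G w ^ suc k) + ∑[ w < m ] (deg G w ^ suc k)
      ∎
    where
      open ≡-Reasoning
      cn = commonNeighbours G S
      κ = constantValues G S

      ∑deg : ∑[ w < m ] deg G w ≡ ∑On d S (λ x → κ x * cn x)
      ∑deg = trans (sum-cong-≗ (λ w → sym (commonNeighbours-fill S ∣S∣≡1+k w))) (sym (∑On-constantValues S cn))

      ∑cn : ∑On d S cn ≡ ∑[ w < m ] (deg G w ^ suc k)
      ∑cn = trans (∑On-commonNeighbours S) (sum-cong-≗ (λ j → cong (deg G j ^_) ∣S∣≡1+k))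

      ∑κcn^ : ∑On d S (λ x → κ x * cn x ^ suc k) ≡ ∑[ w < m ] (deg G w ^ suc k)
      ∑κcn^ = trans (∑On-constantValues S (λ x → cn x ^ suc k))
        (sum-cong-≗ (λ w → cong (_^ suc k) (commonNeighbours-fill S ∣S∣≡1+k w)))

  ∑On-commonNeighbours^ : C4Free G → ∀ {n k} (S : Fin n → Bool) → ∣ S ∣ ≡ suc k →
    ∑On d S (λ x → commonNeighbours G S x ^ suc k) ≡ 2 * ΣV m (λ w → deg G w ^ suc k) ∸ 2 * edges G
  ∑On-commonNeighbours^ c4 {k = k} S ∣S∣≡r = begin
    X                                     ≡⟨ sym (m+n∸n≡m X (2 * edges G)) ⟩
    X + 2 * edges G ∸ 2 * edges G         ≡⟨ cong (λ e → X + e ∸ 2 * edges G) (sym (handshake G)) ⟩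
    X + ∑[ w < m ] deg G w ∸ 2 * edges G  ≡⟨ cong (_∸ 2 * edges G) (∑On-commonNeighbours^+∑deg c4 S ∣S∣≡r) ⟩
    D + D ∸ 2 * edges G                   ≡⟨ cong (λ e → D + e ∸ 2 * edges G) (sym (+-identityʳ D)) ⟩
    2 * D ∸ 2 * edges G                   ≡⟨ cong (λ e → 2 * e ∸ 2 * edges G) (sym (ΣV≡∑ m _)) ⟩
    2 * ΣV m (λ w → deg G w ^ suc k) ∸ 2 * edges G ∎
    where
      open ≡-Reasoning
      X = ∑On d S (λ x → commonNeighbours G S x ^ suc k)
      D = ∑[ w < m ] (deg G w ^ suc k)

-- Homomorphism counts

sum-map-concatMap : ∀ {A B : Set} (f : B → ℕ) (h : A → List.List B) xs →
  List.sum (List.map f (List.concatMap h xs)) ≡ List.sum (List.map (λ a → List.sum (List.map f (h a))) xs)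
sum-map-concatMap f h List.[] = refl
sum-map-concatMap f h (x List.∷ xs) = begin
  List.sum (List.map f (h x List.++ List.concatMap h xs))
    ≡⟨ cong List.sum (List.map-++ f (h x) (List.concatMap h xs)) ⟩
  List.sum (List.map f (h x) List.++ List.map f (List.concatMap h xs))
    ≡⟨ List.sum-++ (List.map f (h x)) _ ⟩
  List.sum (List.map f (h x)) + List.sum (List.map f (List.concatMap h xs))
    ≡⟨ cong (List.sum (List.map f (h x)) +_) (sum-map-concatMap f h xs) ⟩
  List.sum (List.map f (h x)) + List.sum (List.map (λ a → List.sum (List.map f (h a))) xs)
    ∎
  where open ≡-Reasoning

sum-allFuns : ∀ n m (f : (Fin n → Fin m) → ℕ) → (∀ φ ψ → (∀ i → φ i ≡ ψ i) → f φ ≡ f ψ) →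
  List.sum (List.map f (allFuns n m)) ≡ ∑Vec n (λ x → f (lookup x))
sum-allFuns zero m f f-resp = trans (+-identityʳ _) (f-resp _ _ λ ())
sum-allFuns (suc n) m f f-resp = begin
  List.sum (List.map f (List.concatMap (λ g → List.map (λ j → consF j g) (List.allFin m)) (allFuns n m)))
    ≡⟨ sum-map-concatMap f (λ g → List.map (λ j → consF j g) (List.allFin m)) (allFuns n m) ⟩
  List.sum (List.map (λ g → List.sum (List.map f (List.map (λ j → consF j g) (List.allFin m)))) (allFuns n m))
    ≡⟨ cong List.sum (List.map-cong (λ g → trans (cong List.sum (sym (List.map-∘ (List.allFin m)))) (ΣV≡∑ m _)) (allFuns n m)) ⟩
  List.sum (List.map (λ g → ∑[ j < m ] f (consF j g)) (allFuns n m))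
    ≡⟨ sum-allFuns n m (λ g → ∑[ j < m ] f (consF j g)) ∑-f-resp ⟩
  ∑Vec n (λ x → ∑[ j < m ] f (consF j (lookup x)))
    ≡⟨ ∑Vec-∑ n (λ j x → f (consF j (lookup x))) ⟩
  ∑[ j < m ] ∑Vec n (λ x → f (consF j (lookup x)))
    ≡⟨ sum-cong-≗ (λ j → ∑Vec-cong n (λ x → f-resp (consF j (lookup x)) (lookup (j ∷ x)) λ { zero → refl ; (suc i) → refl })) ⟩
  ∑[ j < m ] ∑Vec n (λ x → f (lookup (j ∷ x)))
    ∎
  where
    open ≡-Reasoning
    ∑-f-resp : ∀ φ ψ → (∀ i → φ i ≡ ψ i) → ∑[ j < m ] f (consF j φ) ≡ ∑[ j < m ] f (consF j ψ)
    ∑-f-resp φ ψ φ≗ψ = sum-cong-≗ (λ j → f-resp (consF j φ) (consF j ψ) λ { zero → refl ; (suc i) → φ≗ψ i })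

⌊allᵇ-tabulate⌋ : ∀ {A : Set} {n} (p : A → Bool) (g : Fin n → A) → ⌊ allᵇ p (List.tabulate g) ⌋ ≡ ∏[ i < n ] ⌊ p (g i) ⌋
⌊allᵇ-tabulate⌋ {n = zero} p g = refl
⌊allᵇ-tabulate⌋ {n = suc n} p g with p (g zero)
... | true = trans (⌊allᵇ-tabulate⌋ p (g ∘ suc)) (sym (+-identityʳ _))
... | false = refl

⌊not∨⌋ : ∀ a b → ⌊ not a ∨ b ⌋ ≡ (if a then ⌊ b ⌋ else 1)
⌊not∨⌋ true b = refl
⌊not∨⌋ false b = refl

module _ {n m} (F : Graph n) (G : Graph m) where

  ⌊isHom⌋ : ∀ φ → ⌊ isHom F G φ ⌋ ≡ ∏[ u < n ] ∏On (adj F u) (λ v → ⌊ adj G (φ u) (φ v) ⌋)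
  ⌊isHom⌋ φ = trans (⌊allᵇ-tabulate⌋ (λ u → allᵇ (edgeOK u) (List.allFin n)) (λ u → u))
    (∏-cong (λ u → trans (⌊allᵇ-tabulate⌋ (edgeOK u) (λ v → v)) (∏-cong (λ v → ⌊not∨⌋ (adj F u v) _))))
    where
      edgeOK : Fin n → Fin n → Bool
      edgeOK u v = not (adj F u v) ∨ adj G (φ u) (φ v)

  hom-∑Vec : hom F G ≡ ∑Vec n (λ x → ∏[ u < n ] ∏On (adj F u) (λ v → ⌊ adj G (lookup x u) (lookup x v) ⌋))
  hom-∑Vec = trans (cong List.sum (List.map-cong ⌊isHom⌋ (allFuns n m)))
    (sum-allFuns n m _ (λ φ ψ φ≗ψ → ∏-cong (λ u → ∏-cong (λ v →
      cong₂ (λ a b → if adj F u v then ⌊ adj G a b ⌋ else 1) (φ≗ψ u) (φ≗ψ v)))))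

  module _ (c : Fin n → Bool) (proper : ∀ u v → Adj F u v → c u ≢ c v) where

    opposite-sides : ∀ u v → (not (c u) ∧ adj F u v) ≡ (c v ∧ adj F v u)
    opposite-sides u v with adj F u v in uv
    ... | false = trans (∧-zeroʳ (not (c u))) (sym (trans (cong (c v ∧_) (trans (adj-sym F v u) uv)) (∧-zeroʳ (c v))))
    ... | true = trans (∧-identityʳ (not (c u)))
      (sym (trans (cong (c v ∧_) vu) (trans (∧-identityʳ (c v)) (¬-not (proper v u vu)))))
      where
        vu : Adj F v u
        vu = trans (adj-sym F v u) uv

    ∏On-∏On : ∀ (S : Fin n → Bool) (f : Fin n → Fin n → ℕ) →
      ∏On S (λ u → ∏On (adj F u) (f u)) ≡ ∏[ u < n ] ∏[ v < n ] (if S u ∧ adj F u v then f u v else 1)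
    ∏On-∏On S f = ∏-cong (λ u → by-side (S u))
      where
        by-side : ∀ {u} s → (if s then ∏On (adj F u) (f u) else 1) ≡ ∏[ v < n ] (if s ∧ adj F u v then f u v else 1)
        by-side true = refl
        by-side false = sym (Product.sum-replicate-zero n)

    -- Every edge has exactly one endpoint in each colour class, so both classes see the same edges.
    ∏On-colour-classes : ∀ (a : Fin n → Fin n → ℕ) → (∀ u v → a u v ≡ a v u) →
      ∏On (not ∘ c) (λ u → ∏On (adj F u) (a u)) ≡ ∏On c (λ u → ∏On (adj F u) (a u))
    ∏On-colour-classes a a-sym = begin
      ∏On (not ∘ c) (λ u → ∏On (adj F u) (a u))
        ≡⟨ ∏On-∏On (not ∘ c) a ⟩
      ∏[ u < n ] ∏[ v < n ] (if not (c u) ∧ adj F u v then a u v else 1)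
        ≡⟨ ∏-cong (λ u → ∏-cong (λ v → cong₂ (λ s x → if s then x else 1) (opposite-sides u v) (a-sym u v))) ⟩
      ∏[ u < n ] ∏[ v < n ] (if c v ∧ adj F v u then a v u else 1)
        ≡⟨ ∏-comm (λ u v → if c v ∧ adj F v u then a v u else 1) ⟩
      ∏[ v < n ] ∏[ u < n ] (if c v ∧ adj F v u then a v u else 1)
        ≡⟨ sym (∏On-∏On c a) ⟩
      ∏On c (λ u → ∏On (adj F u) (a u))
        ∎
      where open ≡-Reasoning

    -- Each edge is checked from both endpoints; as all factors are 0 or 1, one colour class suffices.
    ∏-edges-from-one-side : ∀ (a : Fin n → Fin n → ℕ) → (∀ u v → a u v ≡ a v u) → (∀ u v → a u v ≤ 1) →
      ∏[ u < n ] ∏On (adj F u) (a u) ≡ ∏On c (λ u → ∏On (adj F u) (a u))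
    ∏-edges-from-one-side a a-sym a≤1 = begin
      ∏[ u < n ] ∏On (adj F u) (a u)
        ≡⟨ ∏-cong (λ u → if-same (c u)) ⟩
      ∏[ u < n ] (if c u then ∏On (adj F u) (a u) else ∏On (adj F u) (a u))
        ≡⟨ ∏-if c _ _ ⟩
      Y * ∏On (not ∘ c) (λ u → ∏On (adj F u) (a u))
        ≡⟨ cong (Y *_) (∏On-colour-classes a a-sym) ⟩
      Y * Y
        ≡⟨ *-idem-≤1 (∏On≤1 c (λ u → ∏On≤1 (adj F u) (a≤1 u))) ⟩
      Y ∎
      where
        open ≡-Reasoning
        Y = ∏On c (λ u → ∏On (adj F u) (a u))
        if-same : ∀ s {x} → x ≡ (if s then x else x)
        if-same true = refl
        if-same false = refl

    hom-bipartite : (d : Fin m) → hom F G ≡ ∑On d (not ∘ c) (λ x → ∏On c (λ b → commonNeighbours G (adj F b) x))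
    hom-bipartite d = begin
      hom F G
        ≡⟨ hom-∑Vec ⟩
      ∑Vec n (λ z → ∏[ u < n ] ∏On (adj F u) (a z u))
        ≡⟨ ∑Vec-cong n (λ z → ∏-edges-from-one-side (a z) (λ u v → cong ⌊_⌋ (adj-sym G _ _)) (λ u v → ⌊⌋≤1 _)) ⟩
      ∑Vec n (λ z → ∏On c (λ u → ∏On (adj F u) (a z u)))
        ≡⟨ ∑Vec-split d c _ ⟩
      ∑On d (not ∘ c) (λ x → ∑On d c (λ y → ∏On c (λ u → ∏On (adj F u) (a (merge c y x) u))))
        ≡⟨ ∑On-cong d (not ∘ c) (λ x → trans (∑On-cong d c (across x)) (∑On-∏On d c (φ x))) ⟩
      ∑On d (not ∘ c) (λ x → ∏On c (λ b → commonNeighbours G (adj F b) x))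
        ∎
      where
        open ≡-Reasoning
        a : Vec (Fin m) n → Fin n → Fin n → ℕ
        a z u v = ⌊ adj G (lookup z u) (lookup z v) ⌋
        φ : Vec (Fin m) n → Fin n → Fin m → ℕ
        φ x u j = ∏On (adj F u) (λ v → ⌊ adj G j (lookup x v) ⌋)
        across : ∀ x y → ∏On c (λ u → ∏On (adj F u) (a (merge c y x) u)) ≡ ∏On c (λ u → φ x u (lookup y u))
        across x y = ∏On-cong c (λ u cu → ∏On-cong (adj F u) (λ v uv →
          cong₂ (λ p q → ⌊ adj G p q ⌋) (lookup-merge-true c y x cu)
            (lookup-merge-false c y x (trans (¬-not (proper u v uv ∘ sym)) (cong not cu)))))

hom^r≤ : ∀ {n m k} (F : Graph n) (G : Graph m) → Regular F (suc k) →
  (c : Fin n → Bool) → (∀ u v → Adj F u v → c u ≢ c v) → C4Free G → Fin m →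
  hom F G ^ suc k ≤ (2 * ΣV m (λ w → deg G w ^ suc k) ∸ 2 * edges G) ^ ∣ c ∣
hom^r≤ {n} {m} {k} F G regular c proper c4 d = begin
  hom F G ^ suc k
    ≡⟨ cong (_^ suc k) (hom-bipartite F G c proper d) ⟩
  ∑On d (not ∘ c) L ^ suc k
    ≤⟨ finner d (not ∘ c) S H L S⊆A cover dependence (λ x → ≤-reflexive (∏On-^ (suc k) c _)) ⟩
  ∏[ b < n ] ∑On d (S b) (H b)
    ≡⟨ ∏-cong value ⟩
  ∏On c (λ _ → K)
    ≡⟨ ∏On-const c K ⟩
  K ^ ∣ c ∣
    ∎
  where
    open ≤-Reasoning
    K = 2 * ΣV m (λ w → deg G w ^ suc k) ∸ 2 * edges G

    L : Vec (Fin m) n → ℕ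
    L x = ∏On c (λ b → commonNeighbours G (adj F b) x)

    S : Fin n → Fin n → Bool
    S b i = c b ∧ adj F b i

    H : Fin n → Vec (Fin m) n → ℕ
    H b x = if c b then commonNeighbours G (adj F b) x ^ suc k else 1

    other-side : ∀ {b i} → Adj F b i → c b ≡ not (c i)
    other-side bi = ¬-not (proper _ _ bi)

    S⊆A : ∀ b i → S b i ≡ true → not (c i) ≡ true
    S⊆A b i Sbi with c b in cb | adj F b i in bi
    ... | true | true = trans (sym (other-side bi)) cb
    ... | false | _ = contradiction Sbi λ ()
    ... | true | false = contradiction Sbi λ ()

    cover : ∀ i → not (c i) ≡ true → ∑[ b < n ] ⌊ S b i ⌋ ≡ suc k
    cover i ci = trans (sum-cong-≗ (λ b → cong ⌊_⌋ (in-S b))) (trans (sym (deg≡∑ F i)) (regular i))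
      where
        in-S : ∀ b → S b i ≡ adj F i b
        in-S b with adj F b i in bi
        ... | false = trans (∧-zeroʳ (c b)) (sym (trans (adj-sym F i b) bi))
        ... | true = trans (cong (_∧ true) (trans (other-side bi) ci)) (sym (trans (adj-sym F i b) bi))

    dependence : ∀ b → DependsOnlyOn (S b) (H b)
    dependence b x y agree with c b
    ... | false = refl
    ... | true = cong (_^ suc k) (sum-cong-≗ (λ j → ∏On-cong (adj F b) (λ v bv → cong (λ u → ⌊ adj G j u ⌋) (agree v bv))))

    value : ∀ b → ∑On d (S b) (H b) ≡ (if c b then K else 1)
    value b with c b
    ... | false = ∑On-frozen d n (λ _ → 1)
    ... | true = ∑On-commonNeighbours^ G d c4 (adj F b) (trans (sym (deg≡∑ F b)) (regular b))

-- An empty G offers no default vertex for ∑On; there hom F G is 1 or 0 outright.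
hom^2r≤ : ∀ {n m k} (F : Graph n) (G : Graph m) → Regular F (suc k) → Bipartite F → C4Free G →
  hom F G ^ (2 * suc k) ≤ (2 * ΣV m (λ w → deg G w ^ suc k) ∸ 2 * edges G) ^ n
hom^2r≤ {zero} {zero} {k} F G _ _ _ = ≤-reflexive (trans (cong (_^ (2 * suc k)) (hom-∑Vec F G)) (^-zeroˡ (2 * suc k)))
hom^2r≤ {suc n} {zero} {k} F G _ _ _ = subst (λ h → h ^ (2 * suc k) ≤ _) (sym (hom-∑Vec F G)) z≤n
hom^2r≤ {n} {suc m} {k} F G regular (c , proper) c4 = begin
  hom F G ^ (2 * suc k)                 ≡⟨ cong (hom F G ^_) (cong (suc k +_) (+-identityʳ (suc k))) ⟩
  hom F G ^ (suc k + suc k)             ≡⟨ ^-distribˡ-+-* (hom F G) (suc k) (suc k) ⟩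
  hom F G ^ suc k * hom F G ^ suc k     ≤⟨ *-mono-≤ (hom^r≤ F G regular c proper c4 zero)
                                                    (hom^r≤ F G regular (not ∘ c) proper′ c4 zero) ⟩
  K ^ ∣ c ∣ * K ^ ∣ not ∘ c ∣           ≡⟨ sym (^-distribˡ-+-* K ∣ c ∣ ∣ not ∘ c ∣) ⟩
  K ^ (∣ c ∣ + ∣ not ∘ c ∣)             ≡⟨ cong (K ^_) (∣c∣+∣not∘c∣ c) ⟩
  K ^ n                                 ∎
  where
    open ≤-Reasoning
    K = 2 * ΣV (suc m) (λ w → deg G w ^ suc k) ∸ 2 * edges G
    proper′ : ∀ u v → Adj F u v → not (c u) ≢ not (c v)
    proper′ u v uv = proper u v uv ∘ not-injective

-- Connected graphs

minimal : (P : ℕ → Set) → (∀ k → Dec (P k)) → ∀ {n} → P n → ∃[ k ] P k × (∀ j → j < k → ¬ P j)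
minimal P P? {zero} p₀ = 0 , p₀ , λ j ()
minimal P P? {suc n} pₙ with P? 0
... | yes p₀ = 0 , p₀ , λ j ()
... | no ¬p₀ with minimal (P ∘ suc) (P? ∘ suc) pₙ
...   | k , pk , below = suc k , pk , λ { zero _ → ¬p₀ ; (suc j) j<k → below j (s≤s⁻¹ j<k) }

module _ {n} (G : Graph (suc n)) where

  -- v ↦ {v, p v} maps the non-root vertices injectively to edges, as no edge is used in both directions.
  edges-≥-parent : (p : Fin (suc n) → Fin (suc n)) → (∀ v → v ≢ zero → Adj G v (p v)) →
    (∀ u v → Adj G u v → p u ≡ v → p v ≢ u) → n ≤ edges G
  edges-≥-parent p p-adj no-2-cycle = begin
    n                                                     ≡⟨ sym (trans (∑-const n 1) (*-identityʳ n)) ⟩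
    ∑[ y < n ] 1                                          ≡⟨ sum-cong-≗ (λ y → sym (row-nonroot (suc y) λ ())) ⟩
    ∑[ y < n ] ∑[ x < suc n ] Q x (suc y)                 ≤⟨ m≤n+m _ _ ⟩
    ∑[ y < suc n ] ∑[ x < suc n ] Q x y                   ≡⟨ ∑-comm (λ y x → Q x y) ⟩
    ∑[ x < suc n ] ∑[ y < suc n ] Q x y                   ≡⟨ ∑∑-upper-triangle Q Q-diagonal ⟩
    ∑[ x < suc n ] ∑[ y < suc n ] ((Q x y + Q y x) * lt x y)
      ≤⟨ ∑-mono-≤ (λ x → ∑-mono-≤ (λ y → *-monoˡ-≤ (lt x y) (Q-pair x y))) ⟩
    ∑[ x < suc n ] ∑[ y < suc n ] (⌊ adj G x y ⌋ * lt x y) ≡⟨ sym (edges≡∑∑ G) ⟩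
    edges G                                               ∎
    where
      open ≤-Reasoning
      lt : Fin (suc n) → Fin (suc n) → ℕ
      lt x y = ⌊ toℕ x <ᵇ toℕ y ⌋

      Q : Fin (suc n) → Fin (suc n) → ℕ
      Q x y = δ x (p y) * ⌊ adj G y x ⌋

      row-nonroot : ∀ y → y ≢ zero → ∑[ x < suc n ] Q x y ≡ 1
      row-nonroot y y≢0 = trans (∑-δ (λ x → ⌊ adj G y x ⌋) (p y)) (cong ⌊_⌋ (p-adj y y≢0))

      Q-diagonal : ∀ x → Q x x ≡ 0
      Q-diagonal x = trans (cong (λ b → δ x (p x) * ⌊ b ⌋) (irrefl G x)) (*-zeroʳ (δ x (p x)))

      Q-pair : ∀ x y → Q x y + Q y x ≤ ⌊ adj G x y ⌋
      Q-pair x y rewrite adj-sym G y x with adj G x y in xy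
      ... | false = ≤-reflexive (cong₂ _+_ (*-zeroʳ (δ x (p y))) (*-zeroʳ (δ y (p x))))
      ... | true = subst₂ (λ s t → s + t ≤ 1) (sym (*-identityʳ (δ x (p y)))) (sym (*-identityʳ (δ y (p x))))
        (δ+δ≤1 x (p y) y (p x) λ (x≡py , y≡px) → no-2-cycle y x (trans (adj-sym G y x) xy) (sym x≡py) (sym y≡px))

  ReachesRootWithin : ℕ → Fin (suc n) → Set
  ReachesRootWithin zero v = v ≡ zero
  ReachesRootWithin (suc k) v = ReachesRootWithin k v ⊎ ∃[ u ] Adj G v u × ReachesRootWithin k u

  reachesRootWithin? : ∀ k v → Dec (ReachesRootWithin k v)
  reachesRootWithin? zero v = v Fin.≟ zero
  reachesRootWithin? (suc k) v =
    reachesRootWithin? k v ⊎-dec Fin.any? (λ u → (adj G v u ≟ᵇ true) ×-dec reachesRootWithin? k u)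

  walkLength : ∀ {u v} → Walk G u v → ℕ
  walkLength [] = 0
  walkLength (_ ∷ w) = suc (walkLength w)

  walk-reaches : ∀ {v} (w : Walk G v zero) → ReachesRootWithin (walkLength w) v
  walk-reaches [] = refl
  walk-reaches (vu ∷ w) = inj₂ (_ , vu , walk-reaches w)

  module _ (walk : ∀ v → Walk G v zero) where

    depth-spec : ∀ v → ∃[ k ] ReachesRootWithin k v × (∀ j → j < k → ¬ ReachesRootWithin j v)
    depth-spec v = minimal (λ k → ReachesRootWithin k v) (λ k → reachesRootWithin? k v) (walk-reaches (walk v))

    depth : Fin (suc n) → ℕ
    depth v = proj₁ (depth-spec v)

    depth-≤ : ∀ {k v} → ReachesRootWithin k v → depth v ≤ k
    depth-≤ {k} {v} reach = ≮⇒≥ (λ k<depth → proj₂ (proj₂ (depth-spec v)) k k<depth reach)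

    parent-spec : ∀ v → v ≢ zero → ∃[ u ] Adj G v u × depth u < depth v
    parent-spec v v≢0 with depth-spec v
    ... | zero , v≡0 , _ = contradiction v≡0 v≢0
    ... | suc k , inj₁ reach , below = contradiction reach (below k ≤-refl)
    ... | suc k , inj₂ (u , vu , reach) , _ = u , vu , s≤s (depth-≤ reach)

    parent : Fin (suc n) → Fin (suc n)
    parent v with v Fin.≟ zero
    ... | yes _ = zero
    ... | no v≢0 = proj₁ (parent-spec v v≢0)

    parent-step : ∀ v → v ≢ zero → Adj G v (parent v) × depth (parent v) < depth v
    parent-step v v≢0 with v Fin.≟ zero
    ... | yes v≡0 = contradiction v≡0 v≢0
    ... | no v≢0′ = proj₂ (parent-spec v v≢0′)

    parent-of-root : ∀ {v} → v ≡ zero → parent v ≡ zero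
    parent-of-root refl = refl

    parent-no-2-cycle : ∀ u v → Adj G u v → parent u ≡ v → parent v ≢ u
    parent-no-2-cycle u v uv pu≡v pv≡u = by-cases (u Fin.≟ zero) (v Fin.≟ zero)
      where
        by-cases : Dec (u ≡ zero) → Dec (v ≡ zero) → ⊥
        by-cases (yes u≡0) _ = Adj⇒≢ G uv (trans u≡0 (trans (sym (parent-of-root u≡0)) pu≡v))
        by-cases (no _) (yes v≡0) = Adj⇒≢ G uv (trans (sym pv≡u) (trans (parent-of-root v≡0) (sym v≡0)))
        by-cases (no u≢0) (no v≢0) =
          <-asym (subst (λ w → depth w < depth u) pu≡v (proj₂ (parent-step u u≢0)))
                 (subst (λ w → depth w < depth v) pv≡u (proj₂ (parent-step v v≢0)))

connected⇒edges : ∀ {n} (G : Graph n) → Connected G → n ∸ 1 ≤ edges G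
connected⇒edges {zero} G _ = z≤n
connected⇒edges {suc n} G (_ , walks) = edges-≥-parent G (parent G walk) (λ v v≢0 → proj₁ (parent-step G walk v v≢0))
  (parent-no-2-cycle G walk)
  where
    walk : ∀ v → Walk G v zero
    walk v = walks v zero

corollary6 : ∀ {nF nG} (F : Graph nF) (G : Graph nG) (r : ℕ) →
    1 ≤ r → Regular F r → Bipartite F →
    (Bipartite G → C4Free G →
      hom F G ^ (2 * r) ≤ (2 * ΣV nG (λ w → deg G w ^ r) ∸ 2 * edges G) ^ nF)
    × (∀ {nT} (T : Graph nT) → IsTree T →
      hom F T ^ (2 * r) ≤ (2 * ΣV nT (λ w → deg T w ^ r) ∸ 2 * (nT ∸ 1)) ^ nF)
corollary6 {nF} F G (suc k) _ regular bipartite =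
  (λ _ c4 → hom^2r≤ F G regular bipartite c4) ,
  (λ {nT} T (connected , acyclic) → ≤-trans (hom^2r≤ F T regular bipartite (acyclic 1))
    (^-monoˡ-≤ nF (∸-monoʳ-≤ (2 * ΣV nT (λ w → deg T w ^ suc k)) (*-monoʳ-≤ 2 (connected⇒edges T connected)))))
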